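{- Let $f$ be a real symmetric function on pairs of positive integers and let $(a_1,\dots,a_N)$ be a sequence of compressed actions. Apply Algorithm 1 to $(a_1,\dots,a_N)$, expand the output into an (uncompressed) action sequence $(b_1,\dots,b_{n-2})$ by replacing each $ST$ by $SC,CS,TT$ and each $CT$ by $CC,CS,TT$, and apply Algorithm 2 to obtain a link sequence $(1,1,L_3,\dots,L_n)$. Then $(1,1,L_3,\dots,L_n)$ is globally realizable (it is realized by a general polyomino chain with $n$ squares), and $TI_f$ of this general polyomino chain equals the value $TI_f((a_1,\dots,a_N))$ of the initial compressed action sequence.
   Context: Degree-based index: for a graph $G$, $TI_f(G)=\sum_{uv\in E(G)} f(d_u,d_v)$ with $f$ symmetric. General polyomino chains and links: a polyomino system is a finite 2-connected planar graph whose interior faces are unit squares; a general polyomino chain is one whose inner dual (cells adjacent iff sharing an edge) is a path, built by gluing squares $1,2,\dots,n$ successively, square $i+1$ along a side of square $i$. Square 1 is placed, square 2 to its right. A square $i\ge2$ is horizontal/vertical according as it is attached left/right or above/below square $i-1$, with orientation in $\{R,L,U,D\}$. Links $L_1=L_2=1$ and for $i\ge2$: $L_{i+1}=1$ if square $i+1$ has the same direction as square $i$; otherwise, with $j=\max\{1<\ell<i:$ direction of square $\ell\ne$ direction of square $i\}$, $L_{i+1}=2$ if $j$ does not exist or the orientation of square $i+1$ equals that of square $j$, and $L_{i+1}=3$ otherwise. A link sequence is globally realizable if the construction yields a general polyomino chain. Local contributions: $g_f(SS)=3f(3,3)$; $g_f(SC)=3f(3,4)+f(2,4)+f(2,3)-2f(3,3)$;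 $g_f(CS)=f(3,4)-f(2,4)+f(2,3)+2f(3,3)$; $g_f(CC)=f(4,4)+2f(2,4)$; $g_f(TT)=f(2,3)+f(2,4)+f(3,4)+f(4,4)-f(3,3)$; $g_f(ST)=g_f(SC)+g_f(CS)+g_f(TT)$; $g_f(CT)=g_f(CC)+g_f(CS)+g_f(TT)$. Compressed actions: a sequence of compressed actions is $(a_1,\dots,a_N)$ with $a_i\in\{SS,SC,CS,CC,ST,CT\}$; write $F_i\in\{S,C\}$ for the first letter and $S_i\in\{S,C,T\}$ for the second letter of $a_i$. Constraints: $a_1\in\{SS,SC,ST\}$; if $S_i=S$ then $F_{i+1}=S$; if $S_i\in\{C,T\}$ then $F_{i+1}=C$. The number of squares is $n=2+\#\{i: a_i\in\{SS,SC,CS,CC\}\}+3\#\{i:a_i\in\{ST,CT\}\}$. Its value is $TI_f((a_1,\dots,a_N))=c(a_1)+\sum_{i=2}^N g_f(a_i)$, where $c(SS)=2f(2,2)+4f(2,3)+4f(3,3)$, $c(SC)=2f(2,2)+4f(2,3)+2f(3,4)+2f(2,4)$, $c(ST)=c(SC)+g_f(CS)+g_f(TT)$. Algorithm 1 (parity correction): set $m\gets0$; for $i=1,\dots,N$: if $a_i\in\{SC,CC\}$ then $m\gets m+1$; if $a_i\in\{ST,CT\}$ then $m\gets m+2$; if $S_i=T$ and $m$ is odd, let $j=\max\{j<i: S_j=C\}$ (current letters) and replace $a_j$ by $F_jT$ and $a_i$ by $F_iC$. Algorithm 2 (actions to links): given an uncompressed action sequence $(b_1,\dots,b_{n-2})$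 over $\{SS,SC,CS,CC,TT\}$, set $L_1=L_2=1$ and for $i=1,\dots,n-2$: $L_{i+2}=3$ if $b_i=TT$; else $L_{i+2}=1$ if the second letter of $b_i$ is $S$; else $L_{i+2}=2$. The first two squares are placed on a horizontal line. -}

module Defs where

open import Level using (Level)
open import Data.Bool using (Bool; true; false; _∧_; _∨_; not; if_then_else_)
open import Data.Nat using (ℕ; zero; suc; _+_; _≤_; _<_)
open import Data.Integer using (ℤ; ∣_∣; _-_) renaming (_+_ to _+ℤ_; _≟_ to _≟ℤ_)
open import Data.Integer.Base using (+_; -[1+_])
open import Data.List using (List; []; _∷_; reverse; length; map; foldr; concatMap; filter; deduplicateᵇ; lookup)
open import Data.Maybe using (Maybe; just; nothing)
open import Data.Product using (_×_; _,_; proj₁; proj₂)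
open import Data.Fin using (Fin; toℕ)
open import Relation.Nullary using (¬_; does)
open import Relation.Binary.PropositionalEquality using (_≡_; _≢_)
open import Algebra.Bundles using (AbelianGroup)

data CAct : Set where
  SS SC CS CC ST CT : CAct

data Letter : Set where
  S C T : Letter

first : CAct → Letter
first SS = S
first SC = S
first ST = S
first CS = C
first CC = C
first CT = C

second : CAct → Letter
second SS = S
second CS = S
second SC = C
second CC = C
second ST = T
second CT = T

FirstOK : CAct → Set
FirstOK a = first a ≡ S

Follows : CAct → CAct → Set
Follows a b with second a
... | S = first b ≡ S
... | C = first b ≡ C
... | T = first b ≡ C

ChainOK : CAct → List CAct → Set
ChainOK a [] = Data.Unit.⊤ where import Data.Unit
ChainOK a (b ∷ bs) = Follows a b × ChainOK b bs

ValidCompressed : List CAct → Set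
ValidCompressed [] = Data.Empty.⊥ where import Data.Empty
ValidCompressed (a ∷ as) = FirstOK a × ChainOK a as

isT : CAct → Bool
isT a with second a
... | T = true
... | _ = false

isC : CAct → Bool
isC a with second a
... | C = true
... | _ = false

inc : CAct → ℕ
inc SC = 1
inc CC = 1
inc ST = 2
inc CT = 2
inc _  = 0

odd : ℕ → Bool
odd zero = false
odd (suc n) = not (odd n)

toT : CAct → CAct
toT SC = ST
toT CC = CT
toT a  = a

toC : CAct → CAct
toC ST = SC
toC CT = CC
toC a  = a

-- the processed prefix is stored reversed (most recent first); replace the
-- most recent entry whose (current) second letter is C by its T-version
swapLastC : List CAct → Maybe (List CAct)
swapLastC [] = nothing
swapLastC (a ∷ as) with isC a
... | true  = just (toT a ∷ as)
... | false with swapLastC as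
...   | nothing  = nothing
...   | just as' = just (a ∷ as')

alg1Aux : ℕ → List CAct → List CAct → List CAct
alg1Aux m acc [] = reverse acc
alg1Aux m acc (a ∷ as) with isT a ∧ odd (m + inc a)
... | false = alg1Aux (m + inc a) (a ∷ acc) as
... | true with swapLastC acc
...   | just acc' = alg1Aux (m + inc a) (toC a ∷ acc') as
...   | nothing   = alg1Aux (m + inc a) (a ∷ acc) as

algorithm1 : List CAct → List CAct
algorithm1 = alg1Aux 0 []

data Act : Set where
  aSS aSC aCS aCC aTT : Act

expand1 : CAct → List Act
expand1 SS = aSS ∷ []
expand1 SC = aSC ∷ []
expand1 CS = aCS ∷ []
expand1 CC = aCC ∷ []
expand1 ST = aSC ∷ aCS ∷ aTT ∷ []
expand1 CT = aCC ∷ aCS ∷ aTT ∷ []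

expand : List CAct → List Act
expand = concatMap expand1

link : Act → ℕ
link aTT = 3
link aSS = 1
link aCS = 1
link aSC = 2
link aCC = 2

algorithm2 : List Act → List ℕ
algorithm2 bs = 1 ∷ 1 ∷ map link bs

data Dir : Set where
  R L U D : Dir

_==D_ : Dir → Dir → Bool
R ==D R = true
L ==D L = true
U ==D U = true
D ==D D = true
_ ==D _ = false

findDiff : Dir → List Dir → Maybe Dir
findDiff d [] = nothing
findDiff d (e ∷ es) = if e ==D d then findDiff d es else just e

-- hist = d_{i-1},...,d_2 (reversed), cur = d_i, then d_{i+1},...
linksAux : List Dir → Dir → List Dir → List ℕ
linksAux hist cur [] = []
linksAux hist cur (d ∷ ds) = lnk ∷ linksAux (cur ∷ hist) d ds
  where
  lnk : ℕ
  lnk with d ==D cur | findDiff cur hist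
  ... | true  | _       = 1
  ... | false | nothing = 2
  ... | false | just dj = if d ==D dj then 2 else 3

-- A chain is given by the directions d_3,...,d_n of squares 3..n;
-- square 1 is at the origin and square 2 to its right (d_2 = R).
links : List Dir → List ℕ
links ds = 1 ∷ 1 ∷ linksAux [] R ds

Point : Set
Point = ℤ × ℤ

step : Dir → Point → Point
step R (x , y) = (x +ℤ + 1 , y)
step L (x , y) = (x +ℤ -[1+ 0 ] , y)
step U (x , y) = (x , y +ℤ + 1)
step D (x , y) = (x , y +ℤ -[1+ 0 ])

walk : Point → List Dir → List Point
walk p [] = []
walk p (d ∷ ds) = step d p ∷ walk (step d p) ds

-- lower-left corners of the unit squares 1..n
cells : List Dir → List Point
cells ds = (+ 0 , + 0) ∷ (+ 1 , + 0) ∷ walk (+ 1 , + 0) ds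

SharePoint : Point → Point → Set
SharePoint (x , y) (x' , y') = (∣ x - x' ∣ ≤ 1) × (∣ y - y' ∣ ≤ 1)

ShareSide : Point → Point → Set
ShareSide (x , y) (x' , y') = ∣ x - x' ∣ + ∣ y - y' ∣ ≡ 1

-- The cells form a general polyomino chain: they are pairwise distinct,
-- non-consecutive cells share no side (inner dual is a path), and cells
-- whose indices differ by ≥ 3 do not touch at all (no holes, i.e. the
-- union is 2-connected with all interior faces being the cells).
GeneralPolyominoChain : List Dir → Set
GeneralPolyominoChain ds =
  (i j : Fin (length (cells ds))) → toℕ i < toℕ j →
    (lookup (cells ds) i ≢ lookup (cells ds) j)
    × (suc (toℕ i) < toℕ j → ¬ ShareSide (lookup (cells ds) i) (lookup (cells ds) j))
    × (suc (suc (toℕ i)) < toℕ j → ¬ SharePoint (lookup (cells ds) i) (lookup (cells ds) j))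

data Seg : Set where
  H V : ℤ → ℤ → Seg   -- H x y : (x,y)-(x+1,y) ;  V x y : (x,y)-(x,y+1)

_==ℤ_ : ℤ → ℤ → Bool
a ==ℤ b = does (a ≟ℤ b)

_==P_ : Point → Point → Bool
(x , y) ==P (x' , y') = (x ==ℤ x') ∧ (y ==ℤ y')

_==S_ : Seg → Seg → Bool
H x y ==S H x' y' = (x ==ℤ x') ∧ (y ==ℤ y')
V x y ==S V x' y' = (x ==ℤ x') ∧ (y ==ℤ y')
_ ==S _ = false

end₁ end₂ : Seg → Point
end₁ (H x y) = (x , y)
end₁ (V x y) = (x , y)
end₂ (H x y) = (x +ℤ + 1 , y)
end₂ (V x y) = (x , y +ℤ + 1)

cellSegs : Point → List Seg
cellSegs (x , y) = H x y ∷ H x (y +ℤ + 1) ∷ V x y ∷ V (x +ℤ + 1) y ∷ []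

edges : List Dir → List Seg
edges ds = deduplicateᵇ _==S_ (concatMap cellSegs (cells ds))

incident : Point → Seg → Bool
incident p e = (p ==P end₁ e) ∨ (p ==P end₂ e)

degree : List Seg → Point → ℕ
degree E p = length (filter (λ e → Data.Bool.T? (incident p e)) E)
  where import Data.Bool

module Index {c ℓ : Level} (G : AbelianGroup c ℓ) (f : ℕ → ℕ → AbelianGroup.Carrier G) where
  open AbelianGroup G

  Σ' : List Carrier → Carrier
  Σ' = foldr _∙_ ε

  times : ℕ → Carrier → Carrier
  times zero x = ε
  times (suc k) x = x ∙ times k x

  TIchain : List Dir → Carrier
  TIchain ds = Σ' (map (λ e → f (degree E (end₁ e)) (degree E (end₂ e))) E)
    where E = edges ds

  gSS gSC gCS gCC gTT gST gCT : Carrier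
  gSS = times 3 (f 3 3)
  gSC = times 3 (f 3 4) ∙ f 2 4 ∙ f 2 3 ∙ (times 2 (f 3 3)) ⁻¹
  gCS = f 3 4 ∙ (f 2 4) ⁻¹ ∙ f 2 3 ∙ times 2 (f 3 3)
  gCC = f 4 4 ∙ times 2 (f 2 4)
  gTT = f 2 3 ∙ f 2 4 ∙ f 3 4 ∙ f 4 4 ∙ (f 3 3) ⁻¹
  gST = gSC ∙ gCS ∙ gTT
  gCT = gCC ∙ gCS ∙ gTT

  g : CAct → Carrier
  g SS = gSS
  g SC = gSC
  g CS = gCS
  g CC = gCC
  g ST = gST
  g CT = gCT

  -- c(a₁); only defined in the paper for a₁ ∈ {SS,SC,ST}; other values unused
  c₁ : CAct → Carrier
  c₁ SS = times 2 (f 2 2) ∙ times 4 (f 2 3) ∙ times 4 (f 3 3)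
  c₁ SC = times 2 (f 2 2) ∙ times 4 (f 2 3) ∙ times 2 (f 3 4) ∙ times 2 (f 2 4)
  c₁ ST = c₁ SC ∙ gCS ∙ gTT
  c₁ _  = ε

  TIcompressed : List CAct → Carrier
  TIcompressed [] = ε
  TIcompressed (a ∷ as) = c₁ a ∙ Σ' (map g as)

module Submission where

-- The chain is built square by square, one link at a time, and only ever moves right, left or up:
-- link 1 keeps the direction, link 2 turns up after a horizontal run or back to its heading after a
-- vertical run, and link 3 turns to the opposite heading, which needs a vertical run of length at
-- least two in between. The squares are thus stacked row over row, so squares are distinct, only
-- consecutive ones share a side, and squares three or more apart do not even touch: these are the
-- chain conditions. Vertical phases correspond to odd inc-sums, and Algorithm 1 moves every T to an
-- even inc-sum, so the construction can read the whole expanded action sequence.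
--
-- Adding a square only changes the values of edges at its corners, and those are sides of the last
-- four squares; so the increment of the index depends only on that window, and checking the finitely
-- many windows the construction can reach shows that it equals g_f of the action. Algorithm 1
-- preserves the value, since each of its swaps adds g_f(CS) + g_f(TT) to one action and removes it
-- from another.

open import Defs hiding (T)
open import Algebra.Bundles using (AbelianGroup)
import Algebra.Properties.AbelianGroup as AbelianGroupProperties
import Algebra.Solver.CommutativeMonoid as CommutativeMonoidSolver
open import Data.Bool using (Bool; true; false; _∧_; _∨_; not; T; T?; if_then_else_)
import Data.Bool.Properties as BoolP
open import Data.Bool.Properties using (T-∧; T-∨; T-≡)
open import Data.Bool.ListAction using (all; any)
open import Data.Empty using (⊥; ⊥-elim)
open import Data.Fin using (Fin; toℕ)
import Data.Fin as Fin
open import Data.Integer using (ℤ; +_; -[1+_]; ∣_∣; -_) renaming (_+_ to _+ℤ_; _-_ to _-ℤ_; _≟_ to _≟ℤ_)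
import Data.Integer.Properties as ℤP
open import Data.Integer.Tactic.RingSolver using (solve-∀)
open import Data.List using (List; []; _∷_; _++_; map; foldr; concat; concatMap; filter; filterᵇ; deduplicateᵇ; length; lookup; reverse; _ʳ++_)
import Data.List.Properties as ListP
open import Data.List.Membership.Propositional using (_∈_)
open import Data.List.Relation.Binary.Permutation.Propositional.Properties using (map⁺; ↭-reverse)
open import Data.List.Relation.Unary.All as All using (All; []; _∷_; universal)
open import Data.List.Relation.Unary.All.Properties using (++⁺; deduplicate⁺; filter⁺; all-filter; all⁺)
open import Data.List.Relation.Unary.Any as Any using (Any; here; there)
open import Data.List.Relation.Unary.Any.Properties using (any⁺; any⁻)
open import Data.Maybe using (Maybe; just; nothing)
import Data.Maybe as Maybe
open import Data.Nat using (ℕ; zero; suc; _+_; _≤_; _<_; z≤n; s≤s; _≡ᵇ_)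
import Data.Nat.Properties as ℕP
open import Data.Nat.ListAction using (sum)
open import Data.Nat.ListAction.Properties using (sum-↭)
open import Data.Product using (Σ; _×_; _,_; proj₁; proj₂; uncurry)
open import Data.Sum using (_⊎_; inj₁; inj₂)
open import Data.Unit using (⊤; tt)
open import Function using (_∘_)
open import Function.Bundles using (Equivalence)
open import Level using (Level)
open import Relation.Nullary using (¬_; does; yes; no)
open import Relation.Unary using (Pred; Decidable)
open import Relation.Binary.PropositionalEquality using (_≡_; _≢_; refl; sym; trans; cong; cong₂; subst; module ≡-Reasoning)
import Relation.Binary.Reasoning.Setoid as SetoidReasoning
open import Algebra.Properties.AbelianGroup ℤP.+-0-abelianGroup using () renaming (∙-cancelʳ to +-cancelʳ)

private variable
  A B : Set

∧-absorbʳ : ∀ a b → (T b → T a) → a ∧ b ≡ b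
∧-absorbʳ a     false _   = BoolP.∧-zeroʳ a
∧-absorbʳ true  true  _   = refl
∧-absorbʳ false true  b⇒a = ⊥-elim (b⇒a _)

¬T⇒T-not : ∀ b → ¬ T b → T (not b)
¬T⇒T-not false _  = _
¬T⇒T-not true  ¬t = ¬t _


T-not⇒¬T : ∀ b → T (not b) → ¬ T b
T-not⇒¬T true  ()
T-not⇒¬T false _ ()

T-not-∨ : ∀ a b → T (not a ∨ b) → T a → T b
T-not-∨ true  b t _  = t
T-not-∨ false b _ ()

any-++ : ∀ (p : A → Bool) xs ys → any p (xs ++ ys) ≡ any p xs ∨ any p ys
any-++ p [] ys = refl
any-++ p (x ∷ xs) ys = trans (cong (p x ∨_) (any-++ p xs ys)) (sym (BoolP.∨-assoc (p x) _ _))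

filter≡filterᵇ : ∀ {ℓ} {P : Pred A ℓ} (P? : Decidable P) (xs : List A) → filter P? xs ≡ filterᵇ (does ∘ P?) xs
filter≡filterᵇ P? [] = refl
filter≡filterᵇ P? (x ∷ xs) with does (P? x)
... | true  = cong (x ∷_) (filter≡filterᵇ P? xs)
... | false = filter≡filterᵇ P? xs

filterᵇ-cong : ∀ {p q : A → Bool} {xs} → All (λ x → p x ≡ q x) xs → filterᵇ p xs ≡ filterᵇ q xs
filterᵇ-cong [] = refl
filterᵇ-cong {q = q} {x ∷ xs} (px≡qx ∷ eqs) rewrite px≡qx with q x
... | true  = cong (x ∷_) (filterᵇ-cong eqs)
... | false = filterᵇ-cong eqs

filterᵇ-filterᵇ : ∀ (p q : A → Bool) xs → filterᵇ p (filterᵇ q xs) ≡ filterᵇ (λ x → q x ∧ p x) xs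
filterᵇ-filterᵇ p q [] = refl
filterᵇ-filterᵇ p q (x ∷ xs) with q x
... | false = filterᵇ-filterᵇ p q xs
... | true with p x
...   | true  = cong (x ∷_) (filterᵇ-filterᵇ p q xs)
...   | false = filterᵇ-filterᵇ p q xs

filterᵇ-map : ∀ (p : B → Bool) (f : A → B) xs → filterᵇ p (map f xs) ≡ map f (filterᵇ (p ∘ f) xs)
filterᵇ-map p f [] = refl
filterᵇ-map p f (x ∷ xs) with p (f x)
... | true  = cong (f x ∷_) (filterᵇ-map p f xs)
... | false = filterᵇ-map p f xs

deduplicateᵇ-∷ : ∀ (r : A → A → Bool) x xs →
  deduplicateᵇ r (x ∷ xs) ≡ x ∷ filterᵇ (not ∘ r x) (deduplicateᵇ r xs)
deduplicateᵇ-∷ r x xs = cong (x ∷_) (filter≡filterᵇ _ (deduplicateᵇ r xs))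

deduplicateᵇ-++ : ∀ (r : A → A → Bool) xs ys →
  deduplicateᵇ r (xs ++ ys) ≡
  deduplicateᵇ r xs ++ filterᵇ (λ y → not (any (λ x → r x y) xs)) (deduplicateᵇ r ys)
deduplicateᵇ-++ r [] ys = sym (ListP.filter-all (T? ∘ (λ _ → true)) (universal (λ _ → _) (deduplicateᵇ r ys)))
deduplicateᵇ-++ r (x ∷ xs) ys = begin
  deduplicateᵇ r (x ∷ xs ++ ys)
    ≡⟨ deduplicateᵇ-∷ r x (xs ++ ys) ⟩
  x ∷ filterᵇ ¬x (deduplicateᵇ r (xs ++ ys))
    ≡⟨ cong (λ zs → x ∷ filterᵇ ¬x zs) (deduplicateᵇ-++ r xs ys) ⟩
  x ∷ filterᵇ ¬x (deduplicateᵇ r xs ++ filterᵇ ¬xs (deduplicateᵇ r ys))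
    ≡⟨ cong (x ∷_) (ListP.filter-++ (T? ∘ ¬x) (deduplicateᵇ r xs) _) ⟩
  x ∷ filterᵇ ¬x (deduplicateᵇ r xs) ++ filterᵇ ¬x (filterᵇ ¬xs (deduplicateᵇ r ys))
    ≡⟨ cong (λ zs → x ∷ filterᵇ ¬x (deduplicateᵇ r xs) ++ zs) (filterᵇ-filterᵇ ¬x ¬xs (deduplicateᵇ r ys)) ⟩
  x ∷ filterᵇ ¬x (deduplicateᵇ r xs) ++ filterᵇ (λ y → ¬xs y ∧ ¬x y) (deduplicateᵇ r ys)
    ≡⟨ cong₂ _++_ (sym (deduplicateᵇ-∷ r x xs)) (filterᵇ-cong (universal not-any-∷ (deduplicateᵇ r ys))) ⟩
  deduplicateᵇ r (x ∷ xs) ++ filterᵇ (λ y → not (any (λ z → r z y) (x ∷ xs))) (deduplicateᵇ r ys) ∎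
  where
  open ≡-Reasoning
  ¬x = not ∘ r x
  ¬xs = λ y → not (any (λ z → r z y) xs)
  not-any-∷ : ∀ y → (¬xs y ∧ ¬x y) ≡ not (any (λ z → r z y) (x ∷ xs))
  not-any-∷ y with r x y
  ... | true  = BoolP.∧-zeroʳ _
  ... | false = BoolP.∧-identityʳ _

deduplicateᵇ-map : ∀ (r : B → B → Bool) (r' : A → A → Bool) (f : A → B) →
  (∀ a b → r (f a) (f b) ≡ r' a b) → ∀ xs → deduplicateᵇ r (map f xs) ≡ map f (deduplicateᵇ r' xs)
deduplicateᵇ-map r r' f r∘f [] = refl
deduplicateᵇ-map r r' f r∘f (x ∷ xs) = begin
  deduplicateᵇ r (f x ∷ map f xs)              ≡⟨ deduplicateᵇ-∷ r (f x) (map f xs) ⟩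
  f x ∷ filterᵇ (not ∘ r (f x)) (deduplicateᵇ r (map f xs))
    ≡⟨ cong (λ zs → f x ∷ filterᵇ (not ∘ r (f x)) zs) (deduplicateᵇ-map r r' f r∘f xs) ⟩
  f x ∷ filterᵇ (not ∘ r (f x)) (map f (deduplicateᵇ r' xs))
    ≡⟨ cong (f x ∷_) (filterᵇ-map (not ∘ r (f x)) f (deduplicateᵇ r' xs)) ⟩
  f x ∷ map f (filterᵇ (not ∘ r (f x) ∘ f) (deduplicateᵇ r' xs))
    ≡⟨ cong (λ zs → f x ∷ map f zs) (filterᵇ-cong (universal (λ z → cong not (r∘f x z)) (deduplicateᵇ r' xs))) ⟩
  map f (x ∷ filterᵇ (not ∘ r' x) (deduplicateᵇ r' xs))
    ≡⟨ cong (map f) (sym (deduplicateᵇ-∷ r' x xs)) ⟩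
  map f (deduplicateᵇ r' (x ∷ xs)) ∎
  where open ≡-Reasoning

Pair : Set
Pair = ℕ × ℕ

sameUnorderedPair? : Pair → Pair → Bool
sameUnorderedPair? (a , b) (c , d) = ((a ≡ᵇ c) ∧ (b ≡ᵇ d)) ∨ ((a ≡ᵇ d) ∧ (b ≡ᵇ c))

removeUnorderedPair : Pair → List Pair → Maybe (List Pair)
removeUnorderedPair x [] = nothing
removeUnorderedPair x (y ∷ ys) =
  if sameUnorderedPair? x y then just ys else Maybe.map (y ∷_) (removeUnorderedPair x ys)

sameBagOfUnorderedPairs? : List Pair → List Pair → Bool
sameBagOfUnorderedPairs? [] [] = true
sameBagOfUnorderedPairs? [] (_ ∷ _) = false
sameBagOfUnorderedPairs? (x ∷ xs) ys with removeUnorderedPair x ys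
... | just ys' = sameBagOfUnorderedPairs? xs ys'
... | nothing  = false

∧-≡ᵇ⇒≡ : ∀ a b c d → T ((a ≡ᵇ c) ∧ (b ≡ᵇ d)) → (a , b) ≡ (c , d)
∧-≡ᵇ⇒≡ a b c d t with a≡c , b≡d ← Equivalence.to T-∧ t = cong₂ _,_ (ℕP.≡ᵇ⇒≡ a c a≡c) (ℕP.≡ᵇ⇒≡ b d b≡d)

module Sums {c ℓ : Level} (G : AbelianGroup c ℓ) where
  open AbelianGroup G renaming (refl to ≈-refl; sym to ≈-sym; trans to ≈-trans)
  open CommutativeMonoidSolver commutativeMonoid using (solve; _⊜_; _⊕_)

  Σ' : List Carrier → Carrier
  Σ' = foldr _∙_ ε

  Σ'-++ : ∀ {A : Set} (h : A → Carrier) xs ys → Σ' (map h (xs ++ ys)) ≈ Σ' (map h xs) ∙ Σ' (map h ys)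
  Σ'-++ h [] ys = ≈-sym (identityˡ _)
  Σ'-++ h (x ∷ xs) ys = ≈-trans (∙-congˡ (Σ'-++ h xs ys)) (≈-sym (assoc _ _ _))

  Σ'-cong : ∀ {A : Set} {h h' : A → Carrier} {xs} → All (λ x → h x ≈ h' x) xs → Σ' (map h xs) ≈ Σ' (map h' xs)
  Σ'-cong [] = ≈-refl
  Σ'-cong (e ∷ es) = ∙-cong e (Σ'-cong es)

  Σ'-partition : ∀ {A : Set} (h : A → Carrier) (p : A → Bool) xs →
    Σ' (map h xs) ≈ Σ' (map h (filterᵇ p xs)) ∙ Σ' (map h (filterᵇ (not ∘ p) xs))
  Σ'-partition h p [] = ≈-sym (identityˡ _)
  Σ'-partition h p (x ∷ xs) with p x
  ... | true  = ≈-trans (∙-congˡ (Σ'-partition h p xs)) (≈-sym (assoc _ _ _))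
  ... | false = ≈-trans (∙-congˡ (Σ'-partition h p xs))
                  (solve 3 (λ hx a b → hx ⊕ (a ⊕ b) ⊜ a ⊕ (hx ⊕ b)) ≈-refl (h x) _ _)

  module _ (f : ℕ → ℕ → Carrier) (f-sym : ∀ a b → f a b ≈ f b a) where

    uncurry-sameUnorderedPair : ∀ x y → T (sameUnorderedPair? x y) → uncurry f x ≈ uncurry f y
    uncurry-sameUnorderedPair (a , b) (c , d) same with Equivalence.to T-∨ same
    ... | inj₁ t = reflexive (cong (uncurry f) (∧-≡ᵇ⇒≡ a b c d t))
    ... | inj₂ t = ≈-trans (reflexive (cong (uncurry f) (∧-≡ᵇ⇒≡ a b d c t))) (f-sym d c)

    Σ'-removeUnorderedPair : ∀ x ys {ys'} → removeUnorderedPair x ys ≡ just ys' →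
      Σ' (map (uncurry f) ys) ≈ uncurry f x ∙ Σ' (map (uncurry f) ys')
    Σ'-removeUnorderedPair x (y ∷ ys) removed with sameUnorderedPair? x y in same
    Σ'-removeUnorderedPair x (y ∷ ys) refl | true =
      ∙-congʳ (≈-sym (uncurry-sameUnorderedPair x y (Equivalence.from T-≡ same)))
    ... | false with removeUnorderedPair x ys in removed'
    Σ'-removeUnorderedPair x (y ∷ ys) refl | false | just zs =
      ≈-trans (∙-congˡ (Σ'-removeUnorderedPair x ys removed'))
              (solve 3 (λ fy fx s → fy ⊕ (fx ⊕ s) ⊜ fx ⊕ (fy ⊕ s)) ≈-refl (uncurry f y) (uncurry f x) _)

    Σ'-sameBagOfUnorderedPairs : ∀ xs ys → T (sameBagOfUnorderedPairs? xs ys) →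
      Σ' (map (uncurry f) xs) ≈ Σ' (map (uncurry f) ys)
    Σ'-sameBagOfUnorderedPairs [] [] _ = ≈-refl
    Σ'-sameBagOfUnorderedPairs (x ∷ xs) ys same with removeUnorderedPair x ys in removed
    ... | just ys' = ≈-trans (∙-congˡ (Σ'-sameBagOfUnorderedPairs xs ys' same))
                             (≈-sym (Σ'-removeUnorderedPair x ys removed))

==ℤ⇒≡ : ∀ x x' → T (x ==ℤ x') → x ≡ x'
==ℤ⇒≡ x x' eq with x ≟ℤ x'
... | yes x≡x' = x≡x'

==ℤ-refl : ∀ x → T (x ==ℤ x)
==ℤ-refl x with x ≟ℤ x
... | yes _ = _
... | no x≢x = x≢x refl

∧-==ℤ⇒≡ : ∀ x x' y y' → T ((x ==ℤ x') ∧ (y ==ℤ y')) → x ≡ x' × y ≡ y'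
∧-==ℤ⇒≡ x x' y y' eq with x≡x' , y≡y' ← Equivalence.to (T-∧ {x ==ℤ x'}) eq =
  ==ℤ⇒≡ x x' x≡x' , ==ℤ⇒≡ y y' y≡y'

==P⇒≡ : ∀ p p' → T (p ==P p') → p ≡ p'
==P⇒≡ (x , y) (x' , y') eq with refl , refl ← ∧-==ℤ⇒≡ x x' y y' eq = refl

==P-refl : ∀ p → T (p ==P p)
==P-refl (x , y) = Equivalence.from (T-∧ {x ==ℤ x}) (==ℤ-refl x , ==ℤ-refl y)

==S⇒≡ : ∀ s s' → T (s ==S s') → s ≡ s'
==S⇒≡ (H x y) (H x' y') eq with refl , refl ← ∧-==ℤ⇒≡ x x' y y' eq = refl
==S⇒≡ (V x y) (V x' y') eq with refl , refl ← ∧-==ℤ⇒≡ x x' y y' eq = refl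

incident-end₁ : ∀ e → T (incident (end₁ e) e)
incident-end₁ e = Equivalence.from T-∨ (inj₁ (==P-refl (end₁ e)))

incident-end₂ : ∀ e → T (incident (end₂ e) e)
incident-end₂ e = Equivalence.from T-∨ (inj₂ (==P-refl (end₂ e)))

incident⇒endpoint : ∀ q e → T (incident q e) → q ≡ end₁ e ⊎ q ≡ end₂ e
incident⇒endpoint q e inc with Equivalence.to T-∨ inc
... | inj₁ q=e₁ = inj₁ (==P⇒≡ q (end₁ e) q=e₁)
... | inj₂ q=e₂ = inj₂ (==P⇒≡ q (end₂ e) q=e₂)

isCorner : Point → Point → Bool
isCorner q c = any (incident q) (cellSegs c)

SideOf : Point → Seg → Set
SideOf c e = ∀ q → T (incident q e) → T (isCorner q c)

cellSegs-SideOf : ∀ c → All (SideOf c) (cellSegs c)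
cellSegs-SideOf c = (λ q i → any⁺ {xs = cellSegs c} (incident q) (here i))
                  ∷ (λ q i → any⁺ {xs = cellSegs c} (incident q) (there (here i)))
                  ∷ (λ q i → any⁺ {xs = cellSegs c} (incident q) (there (there (here i))))
                  ∷ (λ q i → any⁺ {xs = cellSegs c} (incident q) (there (there (there (here i)))))
                  ∷ []

_∈⟨_,+1⟩ : ℤ → ℤ → Set
a ∈⟨ x ,+1⟩ = a ≡ x ⊎ a ≡ x +ℤ + 1

corner-coordinates : ∀ q c → T (isCorner q c) → proj₁ q ∈⟨ proj₁ c ,+1⟩ × proj₂ q ∈⟨ proj₂ c ,+1⟩
corner-coordinates q (x , y) corner with any⁻ (incident q) (cellSegs (x , y)) corner
... | here inc with incident⇒endpoint q (H x y) inc
...   | inj₁ refl = inj₁ refl , inj₁ refl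
...   | inj₂ refl = inj₂ refl , inj₁ refl
corner-coordinates q (x , y) corner | there (here inc) with incident⇒endpoint q (H x (y +ℤ + 1)) inc
...   | inj₁ refl = inj₁ refl , inj₂ refl
...   | inj₂ refl = inj₂ refl , inj₂ refl
corner-coordinates q (x , y) corner | there (there (here inc)) with incident⇒endpoint q (V x y) inc
...   | inj₁ refl = inj₁ refl , inj₁ refl
...   | inj₂ refl = inj₁ refl , inj₂ refl
corner-coordinates q (x , y) corner | there (there (there (here inc))) with incident⇒endpoint q (V (x +ℤ + 1) y) inc
...   | inj₁ refl = inj₂ refl , inj₁ refl
...   | inj₂ refl = inj₂ refl , inj₂ refl

private
  [x+1]-x≡1 : ∀ x → (x +ℤ + 1) -ℤ x ≡ + 1
  [x+1]-x≡1 = solve-∀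

  x-[x+1]≡-1 : ∀ x → x -ℤ (x +ℤ + 1) ≡ - + 1
  x-[x+1]≡-1 = solve-∀

  x-x'≡[x+1]-[x'+1] : ∀ x x' → x -ℤ x' ≡ (x +ℤ + 1) -ℤ (x' +ℤ + 1)
  x-x'≡[x+1]-[x'+1] = solve-∀

∈⟨,+1⟩⇒∣-∣≤1 : ∀ a x x' → a ∈⟨ x ,+1⟩ → a ∈⟨ x' ,+1⟩ → ∣ x -ℤ x' ∣ ≤ 1
∈⟨,+1⟩⇒∣-∣≤1 a x x' (inj₁ refl) (inj₁ refl) rewrite ℤP.+-inverseʳ a = z≤n
∈⟨,+1⟩⇒∣-∣≤1 a x x' (inj₁ refl) (inj₂ refl) rewrite [x+1]-x≡1 x' = s≤s z≤n
∈⟨,+1⟩⇒∣-∣≤1 a x x' (inj₂ refl) (inj₁ refl) rewrite x-[x+1]≡-1 x = s≤s z≤n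
∈⟨,+1⟩⇒∣-∣≤1 a x x' (inj₂ a≡x+1) (inj₂ a≡x'+1)
  rewrite x-x'≡[x+1]-[x'+1] x x' | sym a≡x+1 | sym a≡x'+1 | ℤP.+-inverseʳ a = z≤n

common-corner⇒SharePoint : ∀ q c c' → T (isCorner q c) → T (isCorner q c') → SharePoint c c'
common-corner⇒SharePoint q (x , y) (x' , y') corner corner'
  with qx , qy ← corner-coordinates q (x , y) corner
     | qx' , qy' ← corner-coordinates q (x' , y') corner' =
  ∈⟨,+1⟩⇒∣-∣≤1 (proj₁ q) x x' qx qx' , ∈⟨,+1⟩⇒∣-∣≤1 (proj₂ q) y y' qy qy'

-- Edges, degrees and locality of the index

segsOf : List Point → List Seg
segsOf = concatMap cellSegs

edgesOf : List Point → List Seg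
edgesOf X = deduplicateᵇ _==S_ (segsOf X)

notIn : List Point → Seg → Bool
notIn X s = not (any (λ t → t ==S s) (segsOf X))

Away : List Point → Point → Set
Away Z q = All (λ z → ¬ T (isCorner q z)) Z

segsOf-++ : ∀ X Y → segsOf (X ++ Y) ≡ segsOf X ++ segsOf Y
segsOf-++ X Y = trans (cong concat (ListP.map-++ cellSegs X Y)) (sym (ListP.concat-++ (map cellSegs X) (map cellSegs Y)))

edgesOf-++ : ∀ X Y → edgesOf (X ++ Y) ≡ edgesOf X ++ filterᵇ (notIn X) (edgesOf Y)
edgesOf-++ X Y rewrite segsOf-++ X Y = deduplicateᵇ-++ _==S_ (segsOf X) (segsOf Y)

segsOf-SideOf : ∀ X → All (λ e → Any (λ c → SideOf c e) X) (segsOf X)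
segsOf-SideOf [] = []
segsOf-SideOf (c ∷ X) = ++⁺ (All.map here (cellSegs-SideOf c)) (All.map there (segsOf-SideOf X))

edgesOf-SideOf : ∀ X → All (λ e → Any (λ c → SideOf c e) X) (edgesOf X)
edgesOf-SideOf X = deduplicate⁺ _ (segsOf-SideOf X)

away⇒¬incident : ∀ Z q e → Away Z q → Any (λ c → SideOf c e) Z → ¬ T (incident q e)
away⇒¬incident (z ∷ Z) q e (¬corner ∷ _) (here side) inc = ¬corner (side q inc)
away⇒¬incident (z ∷ Z) q e (_ ∷ away) (there side) inc = away⇒¬incident Z q e away side inc

away⇒notIn : ∀ Z q e → Away Z q → T (incident q e) → T (notIn Z e)
away⇒notIn Z q e away inc = ¬T⇒T-not _ λ found →
  let equal = any⁻ (λ t → t ==S e) (segsOf Z) found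
      side , same = All.lookupAny (segsOf-SideOf Z) equal
  in away⇒¬incident Z q e away (subst (λ s → Any (λ c → SideOf c s) Z) (==S⇒≡ (Any.lookup equal) e same) side) inc

SelectsAwayFrom : List Point → (Seg → Bool) → Set
SelectsAwayFrom Z b = ∀ e → T (b e) → Σ Point λ q → Away Z q × T (incident q e)

filterᵇ-++-away : ∀ Z W b → SelectsAwayFrom Z b → filterᵇ b (edgesOf (Z ++ W)) ≡ filterᵇ b (edgesOf W)
filterᵇ-++-away Z W b selects = begin
  filterᵇ b (edgesOf (Z ++ W))
    ≡⟨ cong (filterᵇ b) (edgesOf-++ Z W) ⟩
  filterᵇ b (edgesOf Z ++ filterᵇ (notIn Z) (edgesOf W))
    ≡⟨ ListP.filter-++ (T? ∘ b) (edgesOf Z) _ ⟩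
  filterᵇ b (edgesOf Z) ++ filterᵇ b (filterᵇ (notIn Z) (edgesOf W))
    ≡⟨ cong₂ _++_ (ListP.filter-none (T? ∘ b) (All.map (λ {e} → undetected e) (edgesOf-SideOf Z)))
                  (filterᵇ-filterᵇ b (notIn Z) (edgesOf W)) ⟩
  filterᵇ (λ e → notIn Z e ∧ b e) (edgesOf W)
    ≡⟨ filterᵇ-cong (All.universal (λ e → ∧-absorbʳ (notIn Z e) (b e) (detected-notIn e)) (edgesOf W)) ⟩
  filterᵇ b (edgesOf W) ∎
  where
  open ≡-Reasoning
  undetected : ∀ e → Any (λ c → SideOf c e) Z → ¬ T (b e)
  undetected e side be with q , away , inc ← selects e be = away⇒¬incident Z q e away side inc
  detected-notIn : ∀ e → T (b e) → T (notIn Z e)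
  detected-notIn e be with q , away , inc ← selects e be = away⇒notIn Z q e away inc

degree-++-away : ∀ Z W q → Away Z q → degree (edgesOf (Z ++ W)) q ≡ degree (edgesOf W) q
degree-++-away Z W q away = cong length (filterᵇ-++-away Z W (incident q) λ e inc → q , away , inc)

touches : Point → Seg → Bool
touches p e = isCorner (end₁ e) p ∨ isCorner (end₂ e) p

touches⇒common-corner : ∀ p e → T (touches p e) → Σ Point λ q → T (isCorner q p) × T (incident q e)
touches⇒common-corner p e touching with Equivalence.to T-∨ touching
... | inj₁ corner = end₁ e , corner , incident-end₁ e
... | inj₂ corner = end₂ e , corner , incident-end₂ e

newSides : List Point → Point → List Seg
newSides X p = filterᵇ (notIn X) (edgesOf (p ∷ []))

edgesOf-singleton-SideOf : ∀ p → All (SideOf p) (edgesOf (p ∷ []))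
edgesOf-singleton-SideOf p = All.map (λ {e} → fromSingleton e) (edgesOf-SideOf (p ∷ []))
  where
  fromSingleton : ∀ e → Any (λ c → SideOf c e) (p ∷ []) → SideOf p e
  fromSingleton e (here side) = side

newSides-SideOf : ∀ X p → All (SideOf p) (newSides X p)
newSides-SideOf X p = filter⁺ (T? ∘ notIn X) (edgesOf-singleton-SideOf p)

degree-∷ʳ : ∀ X p q → degree (edgesOf (X ++ p ∷ [])) q ≡ degree (edgesOf X) q + degree (newSides X p) q
degree-∷ʳ X p q = begin
  length (filterᵇ (incident q) (edgesOf (X ++ p ∷ [])))
    ≡⟨ cong (length ∘ filterᵇ (incident q)) (edgesOf-++ X (p ∷ [])) ⟩
  length (filterᵇ (incident q) (edgesOf X ++ newSides X p))
    ≡⟨ cong length (ListP.filter-++ (T? ∘ incident q) (edgesOf X) (newSides X p)) ⟩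
  length (filterᵇ (incident q) (edgesOf X) ++ filterᵇ (incident q) (newSides X p))
    ≡⟨ ListP.length-++ (filterᵇ (incident q) (edgesOf X)) ⟩
  degree (edgesOf X) q + degree (newSides X p) q ∎
  where open ≡-Reasoning

degree-newSides-¬corner : ∀ X p q → ¬ T (isCorner q p) → degree (newSides X p) q ≡ 0
degree-newSides-¬corner X p q ¬corner =
  cong length (ListP.filter-none (T? ∘ incident q) (All.map (λ {e} side inc → ¬corner (side q inc)) (newSides-SideOf X p)))

degree-∷ʳ-¬corner : ∀ X p q → ¬ T (isCorner q p) → degree (edgesOf (X ++ p ∷ [])) q ≡ degree (edgesOf X) q
degree-∷ʳ-¬corner X p q ¬corner =
  trans (degree-∷ʳ X p q) (trans (cong (λ n → degree (edgesOf X) q + n) (degree-newSides-¬corner X p q ¬corner)) (ℕP.+-identityʳ _))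

¬SharePoint⇒away : ∀ Z c q → All (λ z → ¬ SharePoint z c) Z → T (isCorner q c) → Away Z q
¬SharePoint⇒away Z c q apart corner =
  All.map (λ {z} ¬shared corner-z → ¬shared (common-corner⇒SharePoint q z c corner-z corner)) apart

notIn-++ : ∀ Z Y s → T (notIn Z s) → notIn (Z ++ Y) s ≡ notIn Y s
notIn-++ Z Y s notInZ rewrite segsOf-++ Z Y | any-++ (λ t → t ==S s) (segsOf Z) (segsOf Y)
  with any (λ t → t ==S s) (segsOf Z)
... | false = refl
... | true  = ⊥-elim notInZ

EndsAway : List Point → Seg → Set
EndsAway Z e = Away Z (end₁ e) × Away Z (end₂ e)

module Values {c ℓ : Level} (G : AbelianGroup c ℓ) (f : ℕ → ℕ → AbelianGroup.Carrier G) where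
  open AbelianGroup G renaming (refl to ≈-refl; sym to ≈-sym; trans to ≈-trans)
  open Sums G
  open SetoidReasoning setoid
  open CommutativeMonoidSolver commutativeMonoid using (solve; _⊜_; _⊕_)

  edgeValue : List Seg → Seg → Carrier
  edgeValue E e = f (degree E (end₁ e)) (degree E (end₂ e))

  TIof : List Point → Carrier
  TIof X = Σ' (map (edgeValue (edgesOf X)) (edgesOf X))

  Σᶠ : List Pair → Carrier
  Σᶠ ps = Σ' (map (uncurry f) ps)

  TIchain≡TIof : ∀ ds → Index.TIchain G f ds ≡ TIof (cells ds)
  TIchain≡TIof ds = refl

  edgeValue-∷ʳ-¬touches : ∀ X p e → ¬ T (touches p e) →
    edgeValue (edgesOf (X ++ p ∷ [])) e ≡ edgeValue (edgesOf X) e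
  edgeValue-∷ʳ-¬touches X p e ¬touching = cong₂ f
    (degree-∷ʳ-¬corner X p (end₁ e) (¬touching ∘ Equivalence.from (T-∨ {isCorner (end₁ e) p}) ∘ inj₁))
    (degree-∷ʳ-¬corner X p (end₂ e) (¬touching ∘ Equivalence.from (T-∨ {isCorner (end₁ e) p}) ∘ inj₂))

  edgeSum : List Seg → List Seg → Carrier
  edgeSum E es = Σ' (map (edgeValue E) es)

  touching untouched : Point → List Point → List Seg
  touching p X = filterᵇ (touches p) (edgesOf X)
  untouched p X = filterᵇ (not ∘ touches p) (edgesOf X)

  TIof-split : ∀ X p → TIof X ≈ edgeSum (edgesOf X) (touching p X) ∙ edgeSum (edgesOf X) (untouched p X)
  TIof-split X p = Σ'-partition (edgeValue (edgesOf X)) (touches p) (edgesOf X)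

  TIof-∷ʳ : ∀ X p → TIof (X ++ p ∷ []) ≈
    (edgeSum (edgesOf (X ++ p ∷ [])) (touching p X) ∙ edgeSum (edgesOf X) (untouched p X))
      ∙ edgeSum (edgesOf (X ++ p ∷ [])) (newSides X p)
  TIof-∷ʳ X p = begin
    edgeSum E' E'                                   ≡⟨ cong (edgeSum E') (edgesOf-++ X (p ∷ [])) ⟩
    edgeSum E' (edgesOf X ++ newSides X p)          ≈⟨ Σ'-++ (edgeValue E') (edgesOf X) (newSides X p) ⟩
    edgeSum E' (edgesOf X) ∙ edgeSum E' (newSides X p)
      ≈⟨ ∙-congʳ (Σ'-partition (edgeValue E') (touches p) (edgesOf X)) ⟩
    (edgeSum E' (touching p X) ∙ edgeSum E' (untouched p X)) ∙ edgeSum E' (newSides X p)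
      ≈⟨ ∙-congʳ (∙-congˡ (Σ'-cong (All.map (λ {e} → reflexive ∘ unchanged e) untouched-edges))) ⟩
    (edgeSum E' (touching p X) ∙ edgeSum (edgesOf X) (untouched p X)) ∙ edgeSum E' (newSides X p) ∎
    where
    E' = edgesOf (X ++ p ∷ [])
    untouched-edges : All (T ∘ not ∘ touches p) (untouched p X)
    untouched-edges = all-filter (T? ∘ not ∘ touches p) (edgesOf X)
    unchanged : ∀ e → T (not (touches p e)) → edgeValue E' e ≡ edgeValue (edgesOf X) e
    unchanged e ¬touching = edgeValue-∷ʳ-¬touches X p e (T-not⇒¬T _ ¬touching)

  edgeValue-++-away : ∀ Z W e → EndsAway Z e → edgeValue (edgesOf (Z ++ W)) e ≡ edgeValue (edgesOf W) e
  edgeValue-++-away Z W e (away₁ , away₂) =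
    cong₂ f (degree-++-away Z W (end₁ e) away₁) (degree-++-away Z W (end₂ e) away₂)

  module _ (Z Y : List Point) (p : Point) (far : All (λ z → ¬ SharePoint z p) Z)
           (shielded : All (λ y → SharePoint y p → All (λ z → ¬ SharePoint z y) Z) Y) where

    private
      before after afterʸ : List Seg
      before = edgesOf (Z ++ Y)
      after = edgesOf ((Z ++ Y) ++ p ∷ [])
      afterʸ = edgesOf (Y ++ p ∷ [])

      after≡ : after ≡ edgesOf (Z ++ (Y ++ p ∷ []))
      after≡ = cong edgesOf (ListP.++-assoc Z Y (p ∷ []))

      corner-away : ∀ q → T (isCorner q p) → Away Z q
      corner-away q = ¬SharePoint⇒away Z p q far

      touching-++ : touching p (Z ++ Y) ≡ touching p Y
      touching-++ = filterᵇ-++-away Z Y (touches p) λ e touching →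
        let q , corner , inc = touches⇒common-corner p e touching in q , corner-away q corner , inc

      newSides-++ : newSides (Z ++ Y) p ≡ newSides Y p
      newSides-++ = filterᵇ-cong (All.map (λ {s} side → notIn-++ Z Y s (new s side)) (edgesOf-singleton-SideOf p))
        where
        new : ∀ s → SideOf p s → T (notIn Z s)
        new s side = away⇒notIn Z (end₁ s) s (corner-away (end₁ s) (side (end₁ s) (incident-end₁ s))) (incident-end₁ s)

      touching-ends-away : All (EndsAway Z) (touching p Y)
      touching-ends-away = All.zipWith (λ {e} → ends-away e)
        (filter⁺ (T? ∘ touches p) (edgesOf-SideOf Y) , all-filter (T? ∘ touches p) (edgesOf Y))
        where
        ends-away : ∀ e → Any (λ y → SideOf y e) Y × T (touches p e) → EndsAway Z e
        ends-away e (side , touching) =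
          let q , corner , inc = touches⇒common-corner p e touching
              shield , sideʸ = All.lookupAny shielded side
              apart = shield (common-corner⇒SharePoint q (Any.lookup side) p (sideʸ q inc) corner)
          in ¬SharePoint⇒away Z (Any.lookup side) (end₁ e) apart (sideʸ (end₁ e) (incident-end₁ e))
           , ¬SharePoint⇒away Z (Any.lookup side) (end₂ e) apart (sideʸ (end₂ e) (incident-end₂ e))

      newSides-ends-away : All (EndsAway Z) (newSides Y p)
      newSides-ends-away = All.map (λ {e} → ends-away e) (newSides-SideOf Y p)
        where
        ends-away : ∀ e → SideOf p e → EndsAway Z e
        ends-away e side = corner-away (end₁ e) (side (end₁ e) (incident-end₁ e))
                         , corner-away (end₂ e) (side (end₂ e) (incident-end₂ e))

      edgeSum-++-away : ∀ W es → All (EndsAway Z) es → edgeSum (edgesOf (Z ++ W)) es ≈ edgeSum (edgesOf W) es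
      edgeSum-++-away W es away = Σ'-cong (All.map (λ {e} → reflexive ∘ edgeValue-++-away Z W e) away)

      touching-before : edgeSum before (touching p (Z ++ Y)) ≈ edgeSum (edgesOf Y) (touching p Y)
      touching-before = begin
        edgeSum before (touching p (Z ++ Y)) ≡⟨ cong (edgeSum before) touching-++ ⟩
        edgeSum before (touching p Y)        ≈⟨ edgeSum-++-away Y (touching p Y) touching-ends-away ⟩
        edgeSum (edgesOf Y) (touching p Y) ∎

      touching-after : edgeSum after (touching p (Z ++ Y)) ≈ edgeSum afterʸ (touching p Y)
      touching-after = begin
        edgeSum after (touching p (Z ++ Y)) ≡⟨ cong₂ edgeSum after≡ touching-++ ⟩
        edgeSum (edgesOf (Z ++ (Y ++ p ∷ []))) (touching p Y)
          ≈⟨ edgeSum-++-away (Y ++ p ∷ []) (touching p Y) touching-ends-away ⟩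
        edgeSum afterʸ (touching p Y) ∎

      newSides-after : edgeSum after (newSides (Z ++ Y) p) ≈ edgeSum afterʸ (newSides Y p)
      newSides-after = begin
        edgeSum after (newSides (Z ++ Y) p) ≡⟨ cong₂ edgeSum after≡ newSides-++ ⟩
        edgeSum (edgesOf (Z ++ (Y ++ p ∷ []))) (newSides Y p)
          ≈⟨ edgeSum-++-away (Y ++ p ∷ []) (newSides Y p) newSides-ends-away ⟩
        edgeSum afterʸ (newSides Y p) ∎

    -- Adding p only changes the values of edges touching p and adds its new sides; all of these are
    -- sides of squares of Y whose corners are away from Z, so the change is the same without Z.
    locality : TIof ((Z ++ Y) ++ p ∷ []) ∙ TIof Y ≈ TIof (Z ++ Y) ∙ TIof (Y ++ p ∷ [])
    locality = begin
      TIof ((Z ++ Y) ++ p ∷ []) ∙ TIof Y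
        ≈⟨ ∙-cong (TIof-∷ʳ (Z ++ Y) p) (TIof-split Y p) ⟩
      ((edgeSum after (touching p (Z ++ Y)) ∙ uA) ∙ edgeSum after (newSides (Z ++ Y) p)) ∙ (tY ∙ uY)
        ≈⟨ ∙-congʳ (∙-cong (∙-congʳ touching-after) newSides-after) ⟩
      ((tY' ∙ uA) ∙ nY') ∙ (tY ∙ uY)
        ≈⟨ solve 5 (λ t' u n t v → ((t' ⊕ u) ⊕ n) ⊕ (t ⊕ v) ⊜ (t ⊕ u) ⊕ ((t' ⊕ v) ⊕ n)) ≈-refl tY' uA nY' tY uY ⟩
      (tY ∙ uA) ∙ ((tY' ∙ uY) ∙ nY')
        ≈⟨ ∙-cong (∙-congʳ (≈-sym touching-before)) (≈-sym (TIof-∷ʳ Y p)) ⟩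
      (edgeSum before (touching p (Z ++ Y)) ∙ uA) ∙ TIof (Y ++ p ∷ [])
        ≈⟨ ∙-congʳ (≈-sym (TIof-split (Z ++ Y) p)) ⟩
      TIof (Z ++ Y) ∙ TIof (Y ++ p ∷ []) ∎
      where
      uA = edgeSum before (untouched p (Z ++ Y))
      tY = edgeSum (edgesOf Y) (touching p Y)
      uY = edgeSum (edgesOf Y) (untouched p Y)
      tY' = edgeSum afterʸ (touching p Y)
      nY' = edgeSum afterʸ (newSides Y p)

-- Translation invariance

translate : Point → Point → Point
translate (a , b) (x , y) = (x +ℤ a , y +ℤ b)

translateSeg : Point → Seg → Seg
translateSeg (a , b) (H x y) = H (x +ℤ a) (y +ℤ b)
translateSeg (a , b) (V x y) = V (x +ℤ a) (y +ℤ b)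

private
  [x+a]+1≡[x+1]+a : ∀ x a → (x +ℤ a) +ℤ + 1 ≡ (x +ℤ + 1) +ℤ a
  [x+a]+1≡[x+1]+a = solve-∀

==ℤ-translate : ∀ x x' a → ((x +ℤ a) ==ℤ (x' +ℤ a)) ≡ (x ==ℤ x')
==ℤ-translate x x' a with x ≟ℤ x' | (x +ℤ a) ≟ℤ (x' +ℤ a)
... | yes _    | yes _  = refl
... | no _     | no _   = refl
... | yes refl | no x≢x = ⊥-elim (x≢x refl)
... | no x≢x'  | yes eq = ⊥-elim (x≢x' (+-cancelʳ a x x' eq))

==P-translate : ∀ v q q' → (translate v q ==P translate v q') ≡ (q ==P q')
==P-translate (a , b) (x , y) (x' , y') = cong₂ _∧_ (==ℤ-translate x x' a) (==ℤ-translate y y' b)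

==S-translate : ∀ v s s' → (translateSeg v s ==S translateSeg v s') ≡ (s ==S s')
==S-translate (a , b) (H x y) (H x' y') = cong₂ _∧_ (==ℤ-translate x x' a) (==ℤ-translate y y' b)
==S-translate (a , b) (V x y) (V x' y') = cong₂ _∧_ (==ℤ-translate x x' a) (==ℤ-translate y y' b)
==S-translate v (H x y) (V x' y') = refl
==S-translate v (V x y) (H x' y') = refl

cellSegs-translate : ∀ v c → cellSegs (translate v c) ≡ map (translateSeg v) (cellSegs c)
cellSegs-translate (a , b) (x , y) rewrite [x+a]+1≡[x+1]+a y b | [x+a]+1≡[x+1]+a x a = refl

end₁-translate : ∀ v s → end₁ (translateSeg v s) ≡ translate v (end₁ s)
end₁-translate v (H x y) = refl
end₁-translate v (V x y) = refl

end₂-translate : ∀ v s → end₂ (translateSeg v s) ≡ translate v (end₂ s)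
end₂-translate (a , b) (H x y) = cong (_, _) ([x+a]+1≡[x+1]+a x a)
end₂-translate (a , b) (V x y) = cong (_ ,_) ([x+a]+1≡[x+1]+a y b)

incident-translate : ∀ v q s → incident (translate v q) (translateSeg v s) ≡ incident q s
incident-translate v q s rewrite end₁-translate v s | end₂-translate v s =
  cong₂ _∨_ (==P-translate v q (end₁ s)) (==P-translate v q (end₂ s))

segsOf-translate : ∀ v X → segsOf (map (translate v) X) ≡ map (translateSeg v) (segsOf X)
segsOf-translate v X = begin
  concat (map cellSegs (map (translate v) X))            ≡⟨ cong concat (sym (ListP.map-∘ X)) ⟩
  concat (map (cellSegs ∘ translate v) X)                ≡⟨ cong concat (ListP.map-cong (cellSegs-translate v) X) ⟩
  concat (map (map (translateSeg v) ∘ cellSegs) X)       ≡⟨ sym (ListP.map-concatMap (translateSeg v) cellSegs X) ⟩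
  map (translateSeg v) (segsOf X) ∎
  where open ≡-Reasoning

edgesOf-translate : ∀ v X → edgesOf (map (translate v) X) ≡ map (translateSeg v) (edgesOf X)
edgesOf-translate v X rewrite segsOf-translate v X =
  deduplicateᵇ-map _==S_ _==S_ (translateSeg v) (==S-translate v) (segsOf X)

degree-translate : ∀ v E q → degree (map (translateSeg v) E) (translate v q) ≡ degree E q
degree-translate v E q = begin
  length (filterᵇ (incident (translate v q)) (map (translateSeg v) E))
    ≡⟨ cong length (filterᵇ-map (incident (translate v q)) (translateSeg v) E) ⟩
  length (map (translateSeg v) (filterᵇ (incident (translate v q) ∘ translateSeg v) E))
    ≡⟨ ListP.length-map (translateSeg v) (filterᵇ (incident (translate v q) ∘ translateSeg v) E) ⟩
  length (filterᵇ (incident (translate v q) ∘ translateSeg v) E)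
    ≡⟨ cong length (filterᵇ-cong (All.universal (incident-translate v q) E)) ⟩
  degree E q ∎
  where open ≡-Reasoning

module _ {c ℓ : Level} (G : AbelianGroup c ℓ) (f : ℕ → ℕ → AbelianGroup.Carrier G) where
  open Values G f
  open Sums G

  TIof-translate : ∀ v X → TIof (map (translate v) X) ≡ TIof X
  TIof-translate v X rewrite edgesOf-translate v X = cong Σ' (begin
    map (edgeValue E') (map (translateSeg v) (edgesOf X)) ≡⟨ sym (ListP.map-∘ (edgesOf X)) ⟩
    map (edgeValue E' ∘ translateSeg v) (edgesOf X)       ≡⟨ ListP.map-cong value (edgesOf X) ⟩
    map (edgeValue (edgesOf X)) (edgesOf X) ∎)
    where
    open ≡-Reasoning
    E' = map (translateSeg v) (edgesOf X)
    value : ∀ e → edgeValue E' (translateSeg v e) ≡ edgeValue (edgesOf X) e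
    value e rewrite end₁-translate v e | end₂-translate v e =
      cong₂ f (degree-translate v (edgesOf X) (end₁ e)) (degree-translate v (edgesOf X) (end₂ e))

translate-comm : ∀ v w → translate v w ≡ translate w v
translate-comm (a , b) (x , y) = cong₂ _,_ (ℤP.+-comm x a) (ℤP.+-comm y b)

-- Building the chain

data Heading : Set where
  rightward leftward : Heading

dirOf : Heading → Dir
dirOf rightward = R
dirOf leftward  = L

opposite : Heading → Heading
opposite rightward = leftward
opposite leftward  = rightward

_·_ : Heading → ℕ → ℤ
rightward · n = + n
leftward  · n = - + n

unit : Heading → ℤ
unit rightward = + 1
unit leftward  = -[1+ 0 ]

-- The chain only ever moves right, left or up. `firstUp σ` / `up σ`: the current square is the
-- first / a later square of a vertical run that follows a horizontal run with heading σ.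
data Phase : Set where
  horizontal firstUp up : Heading → Phase

data LinkType : Set where
  link₁ link₂ link₃ : LinkType

move : Phase → LinkType → Dir × Phase
move (horizontal σ) link₁ = dirOf σ , horizontal σ
move (horizontal σ) link₂ = U , firstUp σ
move (horizontal σ) link₃ = dirOf σ , horizontal σ
move (firstUp σ)    link₁ = U , up σ
move (firstUp σ)    link₂ = dirOf σ , horizontal σ
move (firstUp σ)    link₃ = U , up σ
move (up σ)         link₁ = U , up σ
move (up σ)         link₂ = dirOf σ , horizontal σ
move (up σ)         link₃ = dirOf (opposite σ) , horizontal (opposite σ)

-- A link of type 3 is only possible after a vertical run of length at least two
-- (the values of `move` on the other link₃ inputs are never used).
allowed : Phase → LinkType → Bool
allowed (up σ) link₃ = true
allowed _      link₃ = false
allowed _      _     = true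

-- Where an earlier square c lies relative to the current square Q = c + (dx , dy) when j squares
-- lie strictly between them: in the rows below, or in the current horizontal run.
Behind : Phase → ℕ → ℤ → ℕ → Set
Behind (horizontal σ) j dx dy = 2 ≤ dy ⊎ (dy ≡ 1 × dx ≡ σ · j) ⊎ (dy ≡ 0 × dx ≡ σ · suc j)
Behind (firstUp σ)    j dx dy = 2 ≤ dy ⊎ (dy ≡ 1 × dx ≡ σ · j)
Behind (up σ)         j dx dy = 2 ≤ dy ⊎ (j ≡ 0 × dx ≡ + 0 × dy ≡ 1)

Trails : Phase → ℕ → Point → Point → Set
Trails ph j c Q = Σ ℤ λ dx → Σ ℕ λ dy → Q ≡ translate (dx , + dy) c × Behind ph j dx dy

·-suc : ∀ σ j → σ · j +ℤ unit σ ≡ σ · suc j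
·-suc rightward j = cong +_ (ℕP.+-comm j 1)
·-suc leftward zero = refl
·-suc leftward (suc j) = cong (λ k → -[1+ suc k ]) (ℕP.+-identityʳ j)

·-one : ∀ σ → unit σ ≡ σ · 1
·-one rightward = refl
·-one leftward = refl

·-zero : ∀ σ → + 0 ≡ σ · 0
·-zero rightward = refl
·-zero leftward = refl

step-heading : ∀ σ c dx dy → step (dirOf σ) (translate (dx , + dy) c) ≡ translate (dx +ℤ unit σ , + dy) c
step-heading rightward (x , y) dx dy = cong (_, _) (ℤP.+-assoc x dx (+ 1))
step-heading leftward  (x , y) dx dy = cong (_, _) (ℤP.+-assoc x dx -[1+ 0 ])

step-up : ∀ c dx dy → step U (translate (dx , + dy) c) ≡ translate (dx , + suc dy) c
step-up (x , y) dx dy = cong (_ ,_) (trans (ℤP.+-assoc y (+ dy) (+ 1)) (cong (λ k → y +ℤ + k) (ℕP.+-comm dy 1)))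

step-heading-new : ∀ σ Q → step (dirOf σ) Q ≡ translate (unit σ , + 0) Q
step-heading-new rightward (x , y) = cong (_ ,_) (sym (ℤP.+-identityʳ y))
step-heading-new leftward  (x , y) = cong (_ ,_) (sym (ℤP.+-identityʳ y))

step-up-new : ∀ Q → step U Q ≡ translate (+ 0 , + 1) Q
step-up-new (x , y) = cong (_, _) (sym (ℤP.+-identityʳ x))

private
  2≤-suc : ∀ {n} → 2 ≤ n → 2 ≤ suc n
  2≤-suc 2≤n = ℕP.m≤n⇒m≤1+n 2≤n

trails-step : ∀ ph l → T (allowed ph l) → ∀ {j c Q} → Trails ph j c Q →
  Trails (proj₂ (move ph l)) (suc j) c (step (proj₁ (move ph l)) Q)
trails-step (horizontal σ) link₁ _ {c = c} (dx , dy , refl , inj₁ 2≤dy) =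
  dx +ℤ unit σ , dy , step-heading σ c dx dy , inj₁ 2≤dy
trails-step (horizontal σ) link₁ _ {j} {c} (dx , dy , refl , inj₂ (inj₁ (dy≡1 , refl))) =
  dx +ℤ unit σ , dy , step-heading σ c dx dy , inj₂ (inj₁ (dy≡1 , ·-suc σ j))
trails-step (horizontal σ) link₁ _ {j} {c} (dx , dy , refl , inj₂ (inj₂ (dy≡0 , refl))) =
  dx +ℤ unit σ , dy , step-heading σ c dx dy , inj₂ (inj₂ (dy≡0 , ·-suc σ (suc j)))
trails-step (horizontal σ) link₂ _ {c = c} (dx , dy , refl , inj₁ 2≤dy) =
  dx , suc dy , step-up c dx dy , inj₁ (2≤-suc 2≤dy)
trails-step (horizontal σ) link₂ _ {c = c} (dx , .1 , refl , inj₂ (inj₁ (refl , _))) =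
  dx , 2 , step-up c dx 1 , inj₁ ℕP.≤-refl
trails-step (horizontal σ) link₂ _ {c = c} (dx , .0 , refl , inj₂ (inj₂ (refl , dx≡))) =
  dx , 1 , step-up c dx 0 , inj₂ (refl , dx≡)
trails-step (firstUp σ) link₁ _ {c = c} (dx , dy , refl , inj₁ 2≤dy) =
  dx , suc dy , step-up c dx dy , inj₁ (2≤-suc 2≤dy)
trails-step (firstUp σ) link₁ _ {c = c} (dx , .1 , refl , inj₂ (refl , _)) =
  dx , 2 , step-up c dx 1 , inj₁ ℕP.≤-refl
trails-step (firstUp σ) link₂ _ {c = c} (dx , dy , refl , inj₁ 2≤dy) =
  dx +ℤ unit σ , dy , step-heading σ c dx dy , inj₁ 2≤dy
trails-step (firstUp σ) link₂ _ {j} {c} (dx , dy , refl , inj₂ (dy≡1 , refl)) =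
  dx +ℤ unit σ , dy , step-heading σ c dx dy , inj₂ (inj₁ (dy≡1 , ·-suc σ j))
trails-step (up σ) link₁ _ {c = c} (dx , dy , refl , inj₁ 2≤dy) =
  dx , suc dy , step-up c dx dy , inj₁ (2≤-suc 2≤dy)
trails-step (up σ) link₁ _ {c = c} (dx , .1 , refl , inj₂ (_ , _ , refl)) =
  dx , 2 , step-up c dx 1 , inj₁ ℕP.≤-refl
trails-step (up σ) link₂ _ {c = c} (dx , dy , refl , inj₁ 2≤dy) =
  dx +ℤ unit σ , dy , step-heading σ c dx dy , inj₁ 2≤dy
trails-step (up σ) link₂ _ {c = c} (.(+ 0) , .1 , refl , inj₂ (refl , refl , refl)) =
  + 0 +ℤ unit σ , 1 , step-heading σ c (+ 0) 1 , inj₂ (inj₁ (refl , trans (ℤP.+-identityˡ (unit σ)) (·-one σ)))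
trails-step (up σ) link₃ _ {c = c} (dx , dy , refl , inj₁ 2≤dy) =
  dx +ℤ unit (opposite σ) , dy , step-heading (opposite σ) c dx dy , inj₁ 2≤dy
trails-step (up σ) link₃ _ {c = c} (.(+ 0) , .1 , refl , inj₂ (refl , refl , refl)) =
  + 0 +ℤ unit (opposite σ) , 1 , step-heading (opposite σ) c (+ 0) 1 ,
  inj₂ (inj₁ (refl , trans (ℤP.+-identityˡ (unit (opposite σ))) (·-one (opposite σ))))

trails-new : ∀ ph l → T (allowed ph l) → ∀ Q → Trails (proj₂ (move ph l)) 0 Q (step (proj₁ (move ph l)) Q)
trails-new (horizontal σ) link₁ _ Q = unit σ , 0 , step-heading-new σ Q , inj₂ (inj₂ (refl , ·-one σ))
trails-new (horizontal σ) link₂ _ Q = + 0 , 1 , step-up-new Q , inj₂ (refl , ·-zero σ)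
trails-new (firstUp σ)    link₁ _ Q = + 0 , 1 , step-up-new Q , inj₂ (refl , refl , refl)
trails-new (firstUp σ)    link₂ _ Q = unit σ , 0 , step-heading-new σ Q , inj₂ (inj₂ (refl , ·-one σ))
trails-new (up σ)         link₁ _ Q = + 0 , 1 , step-up-new Q , inj₂ (refl , refl , refl)
trails-new (up σ)         link₂ _ Q = unit σ , 0 , step-heading-new σ Q , inj₂ (inj₂ (refl , ·-one σ))
trails-new (up σ)         link₃ _ Q =
  unit (opposite σ) , 0 , step-heading-new (opposite σ) Q , inj₂ (inj₂ (refl , ·-one (opposite σ)))

Separated : ℕ → Point → Point → Set
Separated j c Q = c ≢ Q × (1 ≤ j → ¬ ShareSide c Q) × (2 ≤ j → ¬ SharePoint c Q)

AbsBehind : ℕ → ℕ → ℕ → Set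
AbsBehind j a b = 2 ≤ b ⊎ (b ≡ 1 × a ≡ j) ⊎ (b ≡ 0 × a ≡ suc j)

∣·∣ : ∀ σ n → ∣ σ · n ∣ ≡ n
∣·∣ rightward n = refl
∣·∣ leftward  n = ℤP.∣-i∣≡∣i∣ (+ n)

behind⇒absBehind : ∀ ph j dx dy → Behind ph j dx dy → AbsBehind j ∣ dx ∣ dy
behind⇒absBehind (horizontal σ) j dx dy (inj₁ 2≤dy) = inj₁ 2≤dy
behind⇒absBehind (horizontal σ) j dx dy (inj₂ (inj₁ (dy≡1 , refl))) = inj₂ (inj₁ (dy≡1 , ∣·∣ σ j))
behind⇒absBehind (horizontal σ) j dx dy (inj₂ (inj₂ (dy≡0 , refl))) = inj₂ (inj₂ (dy≡0 , ∣·∣ σ (suc j)))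
behind⇒absBehind (firstUp σ) j dx dy (inj₁ 2≤dy) = inj₁ 2≤dy
behind⇒absBehind (firstUp σ) j dx dy (inj₂ (dy≡1 , refl)) = inj₂ (inj₁ (dy≡1 , ∣·∣ σ j))
behind⇒absBehind (up σ) j dx dy (inj₁ 2≤dy) = inj₁ 2≤dy
behind⇒absBehind (up σ) j dx dy (inj₂ (refl , refl , refl)) = inj₂ (inj₁ (refl , refl))

private
  2≰1 : ∀ {n} → 2 ≤ n → n ≤ 1 → ⊥
  2≰1 (s≤s (s≤s _)) (s≤s ())

absBehind-≢0 : ∀ {j a b} → AbsBehind j a b → a ≡ 0 → b ≡ 0 → ⊥
absBehind-≢0 (inj₁ 2≤b) _ refl = 2≰1 2≤b z≤n
absBehind-≢0 (inj₂ (inj₁ (b≡1 , _))) _ refl with () ← b≡1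
absBehind-≢0 (inj₂ (inj₂ (_ , a≡suc))) refl _ with () ← a≡suc

absBehind-≢1 : ∀ {j a b} → 1 ≤ j → AbsBehind j a b → a + b ≢ 1
absBehind-≢1 {a = a} {b} _ (inj₁ 2≤b) a+b≡1 = 2≰1 (ℕP.≤-trans 2≤b (ℕP.m≤n+m b a)) (ℕP.≤-reflexive a+b≡1)
absBehind-≢1 (s≤s _) (inj₂ (inj₁ (refl , refl))) a+b≡1 = ℕP.m+1+n≢0 _ (ℕP.suc-injective a+b≡1)
absBehind-≢1 (s≤s _) (inj₂ (inj₂ (refl , refl))) ()

absBehind-≰1 : ∀ {j a b} → 2 ≤ j → AbsBehind j a b → a ≤ 1 → b ≤ 1 → ⊥
absBehind-≰1 _ (inj₁ 2≤b) _ b≤1 = 2≰1 2≤b b≤1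
absBehind-≰1 2≤j (inj₂ (inj₁ (refl , refl))) a≤1 _ = 2≰1 2≤j a≤1
absBehind-≰1 2≤j (inj₂ (inj₂ (refl , refl))) a≤1 _ = 2≰1 (ℕP.m≤n⇒m≤1+n 2≤j) a≤1

private
  ∣x-[x+d]∣≡∣d∣ : ∀ x d → ∣ x -ℤ (x +ℤ d) ∣ ≡ ∣ d ∣
  ∣x-[x+d]∣≡∣d∣ x d = trans (cong ∣_∣ (x-[x+d]≡-d x d)) (ℤP.∣-i∣≡∣i∣ d)
    where
    x-[x+d]≡-d : ∀ x d → x -ℤ (x +ℤ d) ≡ - d
    x-[x+d]≡-d = solve-∀

absBehind⇒separated : ∀ j c dx dy → AbsBehind j ∣ dx ∣ dy → Separated j c (translate (dx , + dy) c)
absBehind⇒separated j (x , y) dx dy behind = distinct , noSide , noPoint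
  where
  Δx : ∣ x -ℤ (x +ℤ dx) ∣ ≡ ∣ dx ∣
  Δx = ∣x-[x+d]∣≡∣d∣ x dx
  Δy : ∣ y -ℤ (y +ℤ + dy) ∣ ≡ dy
  Δy = ∣x-[x+d]∣≡∣d∣ y (+ dy)
  distinct : (x , y) ≢ (x +ℤ dx , y +ℤ + dy)
  distinct same = absBehind-≢0 behind (vanish x dx (cong proj₁ same) Δx) (vanish y (+ dy) (cong proj₂ same) Δy)
    where
    vanish : ∀ z d {n} → z ≡ z +ℤ d → ∣ z -ℤ (z +ℤ d) ∣ ≡ n → n ≡ 0
    vanish z d z≡z+d ∣Δ∣ = trans (sym ∣Δ∣) (trans (cong (λ t → ∣ z -ℤ t ∣) (sym z≡z+d)) (cong ∣_∣ (ℤP.+-inverseʳ z)))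
  noSide : 1 ≤ j → ¬ ShareSide (x , y) (x +ℤ dx , y +ℤ + dy)
  noSide 1≤j side = absBehind-≢1 1≤j behind (trans (sym (cong₂ _+_ Δx Δy)) side)
  noPoint : 2 ≤ j → ¬ SharePoint (x , y) (x +ℤ dx , y +ℤ + dy)
  noPoint 2≤j (close-x , close-y) = absBehind-≰1 2≤j behind (subst (_≤ 1) Δx close-x) (subst (_≤ 1) Δy close-y)

trails⇒separated : ∀ ph j c Q → Trails ph j c Q → Separated j c Q
trails⇒separated ph j c Q (dx , dy , refl , behind) =
  absBehind⇒separated j c dx dy (behind⇒absBehind ph j dx dy behind)

AllByGap : (ℕ → Point → Set) → List Point → Set
AllByGap P [] = ⊤
AllByGap P (c ∷ cs) = P (length cs) c × AllByGap P cs

AllByGap-map : ∀ {P P′ : ℕ → Point → Set} → (∀ k c → P k c → P′ k c) → ∀ cs → AllByGap P cs → AllByGap P′ cs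
AllByGap-map f [] _ = tt
AllByGap-map f (c ∷ cs) (r , rs) = f _ c r , AllByGap-map f cs rs

length-∷ʳ : ∀ (cs : List Point) c → length (cs ++ c ∷ []) ≡ suc (length cs)
length-∷ʳ cs c = trans (ListP.length-++ cs) (ℕP.+-comm (length cs) 1)

AllByGap-∷ʳ : ∀ (P : ℕ → Point → Set) cs c → AllByGap (λ k → P (suc k)) cs → P 0 c → AllByGap P (cs ++ c ∷ [])
AllByGap-∷ʳ P [] c _ r = r , tt
AllByGap-∷ʳ P (d ∷ cs) c (r , rs) r₀ = subst (λ k → P k d) (sym (length-∷ʳ cs c)) r , AllByGap-∷ʳ P cs c rs r₀

AllByGap⇒All : ∀ {P : ℕ → Point → Set} {P₀ : Point → Set} → (∀ k c → P k c → P₀ c) → ∀ cs → AllByGap P cs → All P₀ cs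
AllByGap⇒All f [] _ = []
AllByGap⇒All f (c ∷ cs) (r , rs) = f _ c r ∷ AllByGap⇒All f cs rs

SeparatedFrom : Point → List Point → ℕ → Set
SeparatedFrom c [] j = ⊤
SeparatedFrom c (d ∷ ds) j = Separated j c d × SeparatedFrom c ds (suc j)

PairwiseSeparated : List Point → Set
PairwiseSeparated [] = ⊤
PairwiseSeparated (c ∷ cs) = SeparatedFrom c cs 0 × PairwiseSeparated cs

SeparatedFrom-∷ʳ : ∀ c ds j d → SeparatedFrom c ds j → Separated (j + length ds) c d → SeparatedFrom c (ds ++ d ∷ []) j
SeparatedFrom-∷ʳ c [] j d _ s = subst (λ k → Separated k c d) (ℕP.+-identityʳ j) s , tt
SeparatedFrom-∷ʳ c (e ∷ ds) j d (s , ss) s' =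
  s , SeparatedFrom-∷ʳ c ds (suc j) d ss (subst (λ k → Separated k c d) (ℕP.+-suc j (length ds)) s')

PairwiseSeparated-∷ʳ : ∀ cs d → PairwiseSeparated cs → AllByGap (λ k c → Separated k c d) cs →
  PairwiseSeparated (cs ++ d ∷ [])
PairwiseSeparated-∷ʳ [] d _ _ = tt , tt
PairwiseSeparated-∷ʳ (c ∷ cs) d (s , ss) (s' , ss') = SeparatedFrom-∷ʳ c cs 0 d s s' , PairwiseSeparated-∷ʳ cs d ss ss'

SeparatedFrom-++ : ∀ c ds es j → SeparatedFrom c (ds ++ es) j → SeparatedFrom c es (j + length ds)
SeparatedFrom-++ c [] es j s = subst (SeparatedFrom c es) (sym (ℕP.+-identityʳ j)) s
SeparatedFrom-++ c (d ∷ ds) es j (_ , s) = subst (SeparatedFrom c es) (sym (ℕP.+-suc j (length ds))) (SeparatedFrom-++ c ds es (suc j) s)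

PairwiseSeparated-++ : ∀ cs ds → PairwiseSeparated (cs ++ ds) → AllByGap (λ k c → SeparatedFrom c ds k) cs × PairwiseSeparated ds
PairwiseSeparated-++ [] ds s = tt , s
PairwiseSeparated-++ (c ∷ cs) ds (s , ss) = let r , t = PairwiseSeparated-++ cs ds ss in (SeparatedFrom-++ c cs ds 0 s , r) , t

SeparatedFrom-lookup : ∀ c ds k → SeparatedFrom c ds k → (j : Fin (length ds)) → Separated (k + toℕ j) c (lookup ds j)
SeparatedFrom-lookup c (d ∷ ds) k (s , _) Fin.zero = subst (λ t → Separated t c d) (sym (ℕP.+-identityʳ k)) s
SeparatedFrom-lookup c (d ∷ ds) k (_ , ss) (Fin.suc j) =
  subst (λ t → Separated t c (lookup ds j)) (sym (ℕP.+-suc k (toℕ j))) (SeparatedFrom-lookup c ds (suc k) ss j)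

pairwiseSeparated⇒chain : ∀ ds → PairwiseSeparated (cells ds) → GeneralPolyominoChain ds
pairwiseSeparated⇒chain ds = go (cells ds)
  where
  Chain : List Point → Set
  Chain xs = (i j : Fin (length xs)) → toℕ i < toℕ j →
    (lookup xs i ≢ lookup xs j)
    × (suc (toℕ i) < toℕ j → ¬ ShareSide (lookup xs i) (lookup xs j))
    × (suc (suc (toℕ i)) < toℕ j → ¬ SharePoint (lookup xs i) (lookup xs j))
  go : ∀ xs → PairwiseSeparated xs → Chain xs
  go (c ∷ cs) (s , _) Fin.zero (Fin.suc j) _ with distinct , noSide , noPoint ← SeparatedFrom-lookup c cs 0 s j =
    distinct , (λ { (s≤s 1≤j) → noSide 1≤j }) , (λ { (s≤s 2≤j) → noPoint 2≤j })
  go (c ∷ cs) (_ , ss) (Fin.suc i) (Fin.suc j) (s≤s i<j) with distinct , noSide , noPoint ← go cs ss i j i<j =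
    distinct , (λ { (s≤s lt) → noSide lt }) , (λ { (s≤s lt) → noPoint lt })

origin : Point
origin = (+ 0 , + 0)

unitVector : Dir → Point
unitVector R = (+ 1 , + 0)
unitVector L = (-[1+ 0 ] , + 0)
unitVector U = (+ 0 , + 1)
unitVector D = (+ 0 , -[1+ 0 ])

negate : Point → Point
negate (a , b) = (- a , - b)

lastThree : List Point → List Point
lastThree (_ ∷ W@(_ ∷ _ ∷ _ ∷ [])) = W
lastThree W = W

-- The (at most) three squares preceding the next square, in coordinates relative to it,
-- when W lists the squares preceding the current one relative to the current one.
slide : Dir → List Point → List Point
slide d W = map (translate (negate (unitVector d))) (lastThree (W ++ origin ∷ []))

data Window : List Point → List Point → Set where
  one  : ∀ {a} → Window [] (a ∷ [])
  two  : ∀ {a b} → Window [] (a ∷ b ∷ [])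
  full : ∀ {Z a b c} → Window Z (a ∷ b ∷ c ∷ [])

step≡translate : ∀ d Q → step d Q ≡ translate (unitVector d) Q
step≡translate R (x , y) = cong (_ ,_) (sym (ℤP.+-identityʳ y))
step≡translate L (x , y) = cong (_ ,_) (sym (ℤP.+-identityʳ y))
step≡translate U (x , y) = cong (_, _) (sym (ℤP.+-identityʳ x))
step≡translate D (x , y) = cong (_, _) (sym (ℤP.+-identityʳ x))

translate-origin : ∀ Q → translate Q origin ≡ Q
translate-origin (x , y) = cong₂ _,_ (ℤP.+-identityˡ x) (ℤP.+-identityˡ y)

translate-back : ∀ d Q w → translate (step d Q) (translate (negate (unitVector d)) w) ≡ translate Q w
translate-back d Q (wx , wy) rewrite step≡translate d Q with unitVector d | Q
... | (a , b) | (x , y) = cong₂ _,_ (cancel wx a x) (cancel wy b y)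
  where
  cancel : ∀ w a x → (w +ℤ - a) +ℤ (x +ℤ a) ≡ w +ℤ x
  cancel = solve-∀

reframe : ∀ d Q ws → map (translate (step d Q)) (map (translate (negate (unitVector d))) ws) ≡ map (translate Q) ws
reframe d Q ws = trans (sym (ListP.map-∘ ws)) (ListP.map-cong (translate-back d Q) ws)

window-step : ∀ {Z W} → Window Z W → ∀ Q d → Σ (List Point) λ Z' →
  Window Z' (slide d W) × (Z ++ map (translate Q) W) ++ Q ∷ [] ≡ Z' ++ map (translate (step d Q)) (slide d W)
window-step {W = W} window Q d = go window (sym (reframe d Q (lastThree (W ++ origin ∷ []))))
  where
  Q≡ : Q ≡ translate Q origin
  Q≡ = sym (translate-origin Q)
  go : ∀ {Z W} → Window Z W →
    map (translate Q) (lastThree (W ++ origin ∷ [])) ≡ map (translate (step d Q)) (slide d W) →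
    Σ (List Point) λ Z' →
      Window Z' (slide d W) × (Z ++ map (translate Q) W) ++ Q ∷ [] ≡ Z' ++ map (translate (step d Q)) (slide d W)
  go (one {a}) eq = [] , two , trans (cong (λ q → translate Q a ∷ q ∷ []) Q≡) eq
  go (two {a} {b}) eq = [] , full , trans (cong (λ q → translate Q a ∷ translate Q b ∷ q ∷ []) Q≡) eq
  go (full {Z} {a} {b} {c}) eq = Z ++ translate Q a ∷ [] , full , (begin
    (Z ++ pa ∷ pb ∷ pc ∷ []) ++ Q ∷ []      ≡⟨ ListP.++-assoc Z (pa ∷ pb ∷ pc ∷ []) (Q ∷ []) ⟩
    Z ++ pa ∷ pb ∷ pc ∷ Q ∷ []              ≡⟨ sym (ListP.++-assoc Z (pa ∷ []) (pb ∷ pc ∷ Q ∷ [])) ⟩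
    (Z ++ pa ∷ []) ++ pb ∷ pc ∷ Q ∷ []      ≡⟨ cong (λ q → (Z ++ pa ∷ []) ++ pb ∷ pc ∷ q ∷ []) Q≡ ⟩
    (Z ++ pa ∷ []) ++ map (translate Q) (lastThree ((a ∷ b ∷ c ∷ []) ++ origin ∷ []))  ≡⟨ cong ((Z ++ pa ∷ []) ++_) eq ⟩
    (Z ++ pa ∷ []) ++ map (translate (step d Q)) (slide d (a ∷ b ∷ c ∷ [])) ∎)
    where
    open ≡-Reasoning
    pa = translate Q a
    pb = translate Q b
    pc = translate Q c

shielding : ∀ {Z W} → Window Z W → ∀ Q p → PairwiseSeparated (((Z ++ map (translate Q) W) ++ Q ∷ []) ++ p ∷ []) →
  All (λ z → ¬ SharePoint z p) Z ×
  All (λ y → SharePoint y p → All (λ z → ¬ SharePoint z y) Z) (map (translate Q) W ++ Q ∷ [])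
shielding one Q p _ = [] , All.universal (λ _ _ → []) _
shielding two Q p _ = [] , All.universal (λ _ _ → []) _
shielding (full {Z} {a} {b} {c}) Q p separated = far , shieldA ∷ shieldB ∷ shieldC ∷ shieldQ ∷ []
  where
  pa = translate Q a
  pb = translate Q b
  pc = translate Q c
  reassoc : ((Z ++ pa ∷ pb ∷ pc ∷ []) ++ Q ∷ []) ++ p ∷ [] ≡ Z ++ pa ∷ pb ∷ pc ∷ Q ∷ p ∷ []
  reassoc = trans (ListP.++-assoc (Z ++ pa ∷ pb ∷ pc ∷ []) (Q ∷ []) (p ∷ [])) (ListP.++-assoc Z (pa ∷ pb ∷ pc ∷ []) (Q ∷ p ∷ []))
  split = PairwiseSeparated-++ Z (pa ∷ pb ∷ pc ∷ Q ∷ p ∷ []) (subst PairwiseSeparated reassoc separated)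
  fromZ = proj₁ split
  ¬SharePoint-at : ∀ {j c d} → Separated (suc (suc j)) c d → ¬ SharePoint c d
  ¬SharePoint-at (_ , _ , ¬point) = ¬point (s≤s (s≤s z≤n))
  far : All (λ z → ¬ SharePoint z p) Z
  far = AllByGap⇒All (λ { k z (_ , _ , _ , _ , s , _) → ¬SharePoint-at s }) Z fromZ
  shieldA : SharePoint pa p → All (λ z → ¬ SharePoint z pa) Z
  shieldA with ((_ , _ , _ , s , _) , _) ← proj₂ split = λ shared → ⊥-elim (¬SharePoint-at s shared)
  shieldB : SharePoint pb p → All (λ z → ¬ SharePoint z pb) Z
  shieldB with (_ , (_ , _ , s , _) , _) ← proj₂ split = λ shared → ⊥-elim (¬SharePoint-at s shared)
  shieldC : SharePoint pc p → All (λ z → ¬ SharePoint z pc) Z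
  shieldC _ = AllByGap⇒All (λ { k z (_ , _ , s , _) → ¬SharePoint-at s }) Z fromZ
  shieldQ : SharePoint Q p → All (λ z → ¬ SharePoint z Q) Z
  shieldQ _ = AllByGap⇒All (λ { k z (_ , _ , _ , s , _) → ¬SharePoint-at s }) Z fromZ

absolute-window : ∀ Q W → map (translate Q) W ++ Q ∷ [] ≡ map (translate Q) (W ++ origin ∷ [])
absolute-window Q W = trans (cong (λ q → map (translate Q) W ++ q ∷ []) (sym (translate-origin Q)))
                            (sym (ListP.map-++ (translate Q) W (origin ∷ [])))

absolute-window-∷ʳ : ∀ Q W d →
  (map (translate Q) W ++ Q ∷ []) ++ step d Q ∷ [] ≡ map (translate Q) (W ++ origin ∷ unitVector d ∷ [])
absolute-window-∷ʳ Q W d = begin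
  (map (translate Q) W ++ Q ∷ []) ++ step d Q ∷ []  ≡⟨ ListP.++-assoc (map (translate Q) W) (Q ∷ []) (step d Q ∷ []) ⟩
  map (translate Q) W ++ Q ∷ step d Q ∷ []
    ≡⟨ cong₂ (λ q q' → map (translate Q) W ++ q ∷ q' ∷ [])
             (sym (translate-origin Q)) (trans (step≡translate d Q) (translate-comm (unitVector d) Q)) ⟩
  map (translate Q) W ++ map (translate Q) (origin ∷ unitVector d ∷ [])
    ≡⟨ sym (ListP.map-++ (translate Q) W (origin ∷ unitVector d ∷ [])) ⟩
  map (translate Q) (W ++ origin ∷ unitVector d ∷ []) ∎
  where open ≡-Reasoning

linkType : Act → LinkType
linkType aSS = link₁
linkType aCS = link₁
linkType aSC = link₂
linkType aCC = link₂
linkType aTT = link₃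

linkNumber : LinkType → ℕ
linkNumber link₁ = 1
linkNumber link₂ = 2
linkNumber link₃ = 3

link≡linkNumber : ∀ b → link b ≡ linkNumber (linkType b)
link≡linkNumber aSS = refl
link≡linkNumber aSC = refl
link≡linkNumber aCS = refl
link≡linkNumber aCC = refl
link≡linkNumber aTT = refl

currentDir : Phase → Dir
currentDir (horizontal σ) = dirOf σ
currentDir (firstUp σ) = U
currentDir (up σ) = U

-- What `linksAux` needs to know of the reversed history of directions: the latest direction
-- different from the current one.
LinkHistory : Phase → List Dir → Set
LinkHistory (horizontal σ) hist = findDiff (dirOf σ) hist ≡ nothing ⊎ findDiff (dirOf σ) hist ≡ just U
LinkHistory (firstUp σ) hist = findDiff U hist ≡ just (dirOf σ)
LinkHistory (up σ) hist = findDiff U hist ≡ just (dirOf σ)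

linksAux-move : ∀ ph l → T (allowed ph l) → ∀ hist → LinkHistory ph hist →
  let d , ph' = move ph l in
  linksAux hist (currentDir ph) (d ∷ []) ≡ linkNumber l ∷ []
  × LinkHistory ph' (currentDir ph ∷ hist) × d ≡ currentDir ph'
linksAux-move (horizontal rightward) link₁ _ hist h = refl , h , refl
linksAux-move (horizontal leftward) link₁ _ hist h = refl , h , refl
linksAux-move (horizontal rightward) link₂ _ hist (inj₁ h) rewrite h = refl , refl , refl
linksAux-move (horizontal rightward) link₂ _ hist (inj₂ h) rewrite h = refl , refl , refl
linksAux-move (horizontal leftward) link₂ _ hist (inj₁ h) rewrite h = refl , refl , refl
linksAux-move (horizontal leftward) link₂ _ hist (inj₂ h) rewrite h = refl , refl , refl
linksAux-move (firstUp σ) link₁ _ hist h = refl , h , refl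
linksAux-move (firstUp rightward) link₂ _ hist h rewrite h = refl , inj₂ refl , refl
linksAux-move (firstUp leftward) link₂ _ hist h rewrite h = refl , inj₂ refl , refl
linksAux-move (up σ) link₁ _ hist h = refl , h , refl
linksAux-move (up rightward) link₂ _ hist h rewrite h = refl , inj₂ refl , refl
linksAux-move (up leftward) link₂ _ hist h rewrite h = refl , inj₂ refl , refl
linksAux-move (up rightward) link₃ _ hist h rewrite h = refl , inj₂ refl , refl
linksAux-move (up leftward) link₃ _ hist h rewrite h = refl , inj₂ refl , refl

linkState : List Dir → Dir → List Dir → List Dir × Dir
linkState hist cur [] = hist , cur
linkState hist cur (d ∷ ds) = linkState (cur ∷ hist) d ds

linksAux-∷ʳ : ∀ hist cur ds d → let hist′ , cur′ = linkState hist cur ds in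
  linksAux hist cur (ds ++ d ∷ []) ≡ linksAux hist cur ds ++ linksAux hist′ cur′ (d ∷ [])
linksAux-∷ʳ hist cur [] d = refl
linksAux-∷ʳ hist cur (e ∷ es) d with e ==D cur | findDiff cur hist
... | true  | _       = cong (1 ∷_) (linksAux-∷ʳ (cur ∷ hist) e es d)
... | false | nothing = cong (2 ∷_) (linksAux-∷ʳ (cur ∷ hist) e es d)
... | false | just dj = cong ((if e ==D dj then 2 else 3) ∷_) (linksAux-∷ʳ (cur ∷ hist) e es d)

linkState-∷ʳ : ∀ hist cur ds d →
  linkState hist cur (ds ++ d ∷ []) ≡ (proj₂ (linkState hist cur ds) ∷ proj₁ (linkState hist cur ds) , d)
linkState-∷ʳ hist cur [] d = refl
linkState-∷ʳ hist cur (e ∷ es) d = linkState-∷ʳ (cur ∷ hist) e es d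

walkEnd : Point → List Dir → Point
walkEnd p [] = p
walkEnd p (d ∷ ds) = walkEnd (step d p) ds

walk-∷ʳ : ∀ p ds d → walk p (ds ++ d ∷ []) ≡ walk p ds ++ step d (walkEnd p ds) ∷ []
walk-∷ʳ p [] d = refl
walk-∷ʳ p (e ∷ es) d = cong (step e p ∷_) (walk-∷ʳ (step e p) es d)

walkEnd-∷ʳ : ∀ p ds d → walkEnd p (ds ++ d ∷ []) ≡ step d (walkEnd p ds)
walkEnd-∷ʳ p [] d = refl
walkEnd-∷ʳ p (e ∷ es) d = walkEnd-∷ʳ (step e p) es d

lastCell : List Dir → Point
lastCell = walkEnd (+ 1 , + 0)

cells-∷ʳ : ∀ ds d → cells (ds ++ d ∷ []) ≡ cells ds ++ step d (lastCell ds) ∷ []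
cells-∷ʳ ds d = cong (λ w → (+ 0 , + 0) ∷ (+ 1 , + 0) ∷ w) (walk-∷ʳ (+ 1 , + 0) ds d)

-- The chain with directions ds has been built from the actions `done`; its last square is Q, the
-- squares before it are `far` followed by the window W (relative to Q).
record Built (ds : List Dir) (done : List Act) (ph : Phase) (Q : Point) (W : List Point) : Set where
  field
    links≡ : linksAux [] R ds ≡ map link done
    currentDir≡ : proj₂ (linkState [] R ds) ≡ currentDir ph
    history : LinkHistory ph (proj₁ (linkState [] R ds))
    lastCell≡ : lastCell ds ≡ Q
    far : List Point
    window : Window far W
    cells≡ : cells ds ≡ (far ++ map (translate Q) W) ++ Q ∷ []
    trails : AllByGap (λ j c → Trails ph j c Q) (far ++ map (translate Q) W)
    separated : PairwiseSeparated (cells ds)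

built₀ : Built [] [] (horizontal rightward) (+ 1 , + 0) ((-[1+ 0 ] , + 0) ∷ [])
built₀ = record
  { links≡ = refl
  ; currentDir≡ = refl
  ; history = inj₁ refl
  ; lastCell≡ = refl
  ; far = []
  ; window = one
  ; cells≡ = refl
  ; trails = (+ 1 , 0 , refl , inj₂ (inj₂ (refl , refl))) , _
  ; separated = (((λ ()) , (λ ()) , (λ ())) , _) , _
  }

module _ {ds done ph Q W} (B : Built ds done ph Q W) (b : Act) where
  open Built B
  private
    d = proj₁ (move ph (linkType b))
    ph' = proj₂ (move ph (linkType b))
    p = step d Q

  cells-extend : cells (ds ++ d ∷ []) ≡ ((far ++ map (translate Q) W) ++ Q ∷ []) ++ p ∷ []
  cells-extend = trans (cells-∷ʳ ds d) (cong₂ (λ cs q → cs ++ step d q ∷ []) cells≡ lastCell≡)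

  links-extend : T (allowed ph (linkType b)) → linksAux [] R (ds ++ d ∷ []) ≡ map link (done ++ b ∷ [])
  links-extend ok = begin
    linksAux [] R (ds ++ d ∷ [])
      ≡⟨ linksAux-∷ʳ [] R ds d ⟩
    linksAux [] R ds ++ linksAux (proj₁ (linkState [] R ds)) (proj₂ (linkState [] R ds)) (d ∷ [])
      ≡⟨ cong₂ (λ ls c → ls ++ linksAux (proj₁ (linkState [] R ds)) c (d ∷ [])) links≡ currentDir≡ ⟩
    map link done ++ linksAux (proj₁ (linkState [] R ds)) (currentDir ph) (d ∷ [])
      ≡⟨ cong (map link done ++_) (proj₁ (linksAux-move ph (linkType b) ok (proj₁ (linkState [] R ds)) history)) ⟩
    map link done ++ linkNumber (linkType b) ∷ []
      ≡⟨ cong (λ n → map link done ++ n ∷ []) (sym (link≡linkNumber b)) ⟩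
    map link done ++ map link (b ∷ [])
      ≡⟨ sym (ListP.map-++ link done (b ∷ [])) ⟩
    map link (done ++ b ∷ []) ∎
    where open ≡-Reasoning

  trails-extend : T (allowed ph (linkType b)) →
    AllByGap (λ j c → Trails ph' j c p) ((far ++ map (translate Q) W) ++ Q ∷ [])
  trails-extend ok = AllByGap-∷ʳ (λ j c → Trails ph' j c p) _ Q
    (AllByGap-map (λ j c → trails-step ph (linkType b) ok {j} {c} {Q}) _ trails) (trails-new ph (linkType b) ok Q)

  extend : T (allowed ph (linkType b)) → Built (ds ++ d ∷ []) (done ++ b ∷ []) ph' p (slide d W)
  extend ok = record
    { links≡ = links-extend ok
    ; currentDir≡ = trans (cong proj₂ (linkState-∷ʳ [] R ds d)) (proj₂ (proj₂ moved))
    ; history = subst (LinkHistory ph') (sym (cong proj₁ (linkState-∷ʳ [] R ds d)))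
        (subst (λ c → LinkHistory ph' (c ∷ proj₁ (linkState [] R ds))) (sym currentDir≡) (proj₁ (proj₂ moved)))
    ; lastCell≡ = trans (walkEnd-∷ʳ (+ 1 , + 0) ds d) (cong (step d) lastCell≡)
    ; far = proj₁ slid
    ; window = proj₁ (proj₂ slid)
    ; cells≡ = trans cells-extend (cong (_++ p ∷ []) (proj₂ (proj₂ slid)))
    ; trails = subst (AllByGap (λ j c → Trails ph' j c p)) (proj₂ (proj₂ slid)) (trails-extend ok)
    ; separated = subst PairwiseSeparated (sym cells-extend)
        (PairwiseSeparated-∷ʳ _ p (subst PairwiseSeparated cells≡ separated)
          (AllByGap-map (λ j c → trails⇒separated ph' j c p) _ (trails-extend ok)))
    }
    where
    slid = window-step window Q d
    moved = linksAux-move ph (linkType b) ok (proj₁ (linkState [] R ds)) history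

-- After an action with second letter S only actions with first letter S may follow, after C only
-- those with first letter C; TT is only admitted directly after CS (as in the expansion of ST, CT).
data Kind : Set where
  afterS afterC afterCS : Kind

admits : Kind → Act → Bool
admits afterS  aSS = true
admits afterCS aSS = true
admits afterS  aSC = true
admits afterCS aSC = true
admits afterC  aCS = true
admits afterC  aCC = true
admits afterCS aTT = true
admits _       _   = false

kindAfter : Act → Kind
kindAfter aSS = afterS
kindAfter aCS = afterCS
kindAfter aSC = afterC
kindAfter aCC = afterC
kindAfter aTT = afterC

record LocalState : Set where
  constructor local
  field
    phase : Phase
    kind : Kind
    window : List Point

admissible? : Phase → Kind → Act → Bool
admissible? ph k b = admits k b ∧ allowed ph (linkType b)

next : LocalState → Act → LocalState
next (local ph k W) b = local (proj₂ (move ph (linkType b))) (kindAfter b) (slide (proj₁ (move ph (linkType b))) W)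

-- g_f(b) as a formal difference of degree pairs: g_f(b) = Σ f (g⁺ b) − Σ f (g⁻ b).
g⁺ g⁻ : Act → List Pair
g⁺ aSS = (3 , 3) ∷ (3 , 3) ∷ (3 , 3) ∷ []
g⁺ aSC = (3 , 4) ∷ (3 , 4) ∷ (3 , 4) ∷ (2 , 4) ∷ (2 , 3) ∷ []
g⁺ aCS = (3 , 4) ∷ (2 , 3) ∷ (3 , 3) ∷ (3 , 3) ∷ []
g⁺ aCC = (4 , 4) ∷ (2 , 4) ∷ (2 , 4) ∷ []
g⁺ aTT = (2 , 3) ∷ (2 , 4) ∷ (3 , 4) ∷ (4 , 4) ∷ []
g⁻ aSS = []
g⁻ aSC = (3 , 3) ∷ (3 , 3) ∷ []
g⁻ aCS = (2 , 4) ∷ []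
g⁻ aCC = []
g⁻ aTT = (3 , 3) ∷ []

degreePairs : List Point → List Pair
degreePairs X = map (λ e → degree (edgesOf X) (end₁ e) , degree (edgesOf X) (end₂ e)) (edgesOf X)

-- Adding the next square to the window and the current square changes the degree pairs by g(b).
localChange? : LocalState → Act → Bool
localChange? (local ph k W) b =
  sameBagOfUnorderedPairs? (degreePairs (W ++ origin ∷ unitVector (proj₁ (move ph (linkType b))) ∷ []) ++ g⁻ b)
                           (degreePairs (W ++ origin ∷ []) ++ g⁺ b)

sameHeading? : Heading → Heading → Bool
sameHeading? rightward rightward = true
sameHeading? leftward  leftward  = true
sameHeading? _         _         = false

samePhase? : Phase → Phase → Bool
samePhase? (horizontal σ) (horizontal τ) = sameHeading? σ τ
samePhase? (firstUp σ)    (firstUp τ)    = sameHeading? σ τ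
samePhase? (up σ)         (up τ)         = sameHeading? σ τ
samePhase? _              _              = false

sameKind? : Kind → Kind → Bool
sameKind? afterS  afterS  = true
sameKind? afterC  afterC  = true
sameKind? afterCS afterCS = true
sameKind? _       _       = false

samePoints? : List Point → List Point → Bool
samePoints? [] [] = true
samePoints? (p ∷ ps) (q ∷ qs) = (p ==P q) ∧ samePoints? ps qs
samePoints? _ _ = false

sameLocalState? : LocalState → LocalState → Bool
sameLocalState? (local ph k W) (local ph' k' W') = samePhase? ph ph' ∧ (sameKind? k k' ∧ samePoints? W W')

sameHeading⇒≡ : ∀ σ τ → T (sameHeading? σ τ) → σ ≡ τ
sameHeading⇒≡ rightward rightward _ = refl
sameHeading⇒≡ leftward  leftward  _ = refl

samePhase⇒≡ : ∀ ph ph' → T (samePhase? ph ph') → ph ≡ ph'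
samePhase⇒≡ (horizontal σ) (horizontal τ) same = cong horizontal (sameHeading⇒≡ σ τ same)
samePhase⇒≡ (firstUp σ)    (firstUp τ)    same = cong firstUp (sameHeading⇒≡ σ τ same)
samePhase⇒≡ (up σ)         (up τ)         same = cong up (sameHeading⇒≡ σ τ same)

sameKind⇒≡ : ∀ k k' → T (sameKind? k k') → k ≡ k'
sameKind⇒≡ afterS  afterS  _ = refl
sameKind⇒≡ afterC  afterC  _ = refl
sameKind⇒≡ afterCS afterCS _ = refl

samePoints⇒≡ : ∀ ps qs → T (samePoints? ps qs) → ps ≡ qs
samePoints⇒≡ [] [] _ = refl
samePoints⇒≡ (p ∷ ps) (q ∷ qs) same with p=q , ps=qs ← Equivalence.to (T-∧ {p ==P q}) same =
  cong₂ _∷_ (==P⇒≡ p q p=q) (samePoints⇒≡ ps qs ps=qs)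

sameLocalState⇒≡ : ∀ s s' → T (sameLocalState? s s') → s ≡ s'
sameLocalState⇒≡ (local ph k W) (local ph' k' W') same
  with ph=ph' , rest ← Equivalence.to (T-∧ {samePhase? ph ph'}) same
  with k=k' , W=W' ← Equivalence.to (T-∧ {sameKind? k k'}) rest
  with refl ← samePhase⇒≡ ph ph' ph=ph' | refl ← sameKind⇒≡ k k' k=k' | refl ← samePoints⇒≡ W W' W=W' = refl

-- The local states reachable from the one after the first action, found by exploration.
reachable : List LocalState
reachable =
  local (horizontal rightward) afterS ((-[1+ 1 ] , + 0) ∷ (-[1+ 0 ] , + 0) ∷ []) ∷
  local (firstUp rightward) afterC ((-[1+ 0 ] , -[1+ 0 ]) ∷ (+ 0 , -[1+ 0 ]) ∷ []) ∷
  local (horizontal rightward) afterS ((-[1+ 2 ] , + 0) ∷ (-[1+ 1 ] , + 0) ∷ (-[1+ 0 ] , + 0) ∷ []) ∷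
  local (firstUp rightward) afterC ((-[1+ 1 ] , -[1+ 0 ]) ∷ (-[1+ 0 ] , -[1+ 0 ]) ∷ (+ 0 , -[1+ 0 ]) ∷ []) ∷
  local (up rightward) afterCS ((-[1+ 0 ] , -[1+ 1 ]) ∷ (+ 0 , -[1+ 1 ]) ∷ (+ 0 , -[1+ 0 ]) ∷ []) ∷
  local (horizontal rightward) afterC ((-[1+ 1 ] , -[1+ 0 ]) ∷ (-[1+ 0 ] , -[1+ 0 ]) ∷ (-[1+ 0 ] , + 0) ∷ []) ∷
  local (up rightward) afterS ((+ 0 , -[1+ 2 ]) ∷ (+ 0 , -[1+ 1 ]) ∷ (+ 0 , -[1+ 0 ]) ∷ []) ∷
  local (horizontal rightward) afterC ((-[1+ 0 ] , -[1+ 1 ]) ∷ (-[1+ 0 ] , -[1+ 0 ]) ∷ (-[1+ 0 ] , + 0) ∷ []) ∷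
  local (horizontal leftward) afterC ((+ 1 , -[1+ 1 ]) ∷ (+ 1 , -[1+ 0 ]) ∷ (+ 1 , + 0) ∷ []) ∷
  local (horizontal rightward) afterCS ((-[1+ 1 ] , -[1+ 0 ]) ∷ (-[1+ 1 ] , + 0) ∷ (-[1+ 0 ] , + 0) ∷ []) ∷
  local (firstUp rightward) afterC ((-[1+ 0 ] , -[1+ 1 ]) ∷ (-[1+ 0 ] , -[1+ 0 ]) ∷ (+ 0 , -[1+ 0 ]) ∷ []) ∷
  local (horizontal leftward) afterCS ((+ 2 , -[1+ 0 ]) ∷ (+ 2 , + 0) ∷ (+ 1 , + 0) ∷ []) ∷
  local (firstUp leftward) afterC ((+ 1 , -[1+ 1 ]) ∷ (+ 1 , -[1+ 0 ]) ∷ (+ 0 , -[1+ 0 ]) ∷ []) ∷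
  local (horizontal leftward) afterS ((+ 3 , + 0) ∷ (+ 2 , + 0) ∷ (+ 1 , + 0) ∷ []) ∷
  local (firstUp leftward) afterC ((+ 2 , -[1+ 0 ]) ∷ (+ 1 , -[1+ 0 ]) ∷ (+ 0 , -[1+ 0 ]) ∷ []) ∷
  local (up leftward) afterCS ((+ 1 , -[1+ 1 ]) ∷ (+ 0 , -[1+ 1 ]) ∷ (+ 0 , -[1+ 0 ]) ∷ []) ∷
  local (horizontal leftward) afterC ((+ 2 , -[1+ 0 ]) ∷ (+ 1 , -[1+ 0 ]) ∷ (+ 1 , + 0) ∷ []) ∷
  local (up leftward) afterS ((+ 0 , -[1+ 2 ]) ∷ (+ 0 , -[1+ 1 ]) ∷ (+ 0 , -[1+ 0 ]) ∷ []) ∷ []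

allActs : List Act
allActs = aSS ∷ aSC ∷ aCS ∷ aCC ∷ aTT ∷ []

closedStep? : LocalState → Act → Bool
closedStep? s b =
  not (admissible? (LocalState.phase s) (LocalState.kind s) b)
  ∨ (any (sameLocalState? (next s b)) reachable ∧ localChange? s b)

reachable-closed : T (all (λ s → all (closedStep? s) allActs) reachable)
reachable-closed = _

∈allActs : ∀ b → b ∈ allActs
∈allActs aSS = here refl
∈allActs aSC = there (here refl)
∈allActs aCS = there (there (here refl))
∈allActs aCC = there (there (there (here refl)))
∈allActs aTT = there (there (there (there (here refl))))

closedStep : ∀ {s} → s ∈ reachable → ∀ b → T (closedStep? s b)
closedStep {s} s∈ b = All.lookup (all⁺ (closedStep? s) allActs
  (All.lookup (all⁺ (λ s → all (closedStep? s) allActs) reachable reachable-closed) s∈)) (∈allActs b)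

reachable-step : ∀ {ph k W} → local ph k W ∈ reachable → ∀ b → T (admissible? ph k b) →
  next (local ph k W) b ∈ reachable × T (localChange? (local ph k W) b)
reachable-step {ph} {k} {W} s∈ b ok
  with reached , change ← Equivalence.to T-∧ (T-not-∨ (admissible? ph k b) _ (closedStep s∈ b) ok) =
  Any.map (sameLocalState⇒≡ s′ _) (any⁻ (sameLocalState? s′) reachable reached) , change
  where s′ = next (local ph k W) b

-- Increments of the index

module Increments {c ℓ : Level} (G : AbelianGroup c ℓ) (f : ℕ → ℕ → AbelianGroup.Carrier G)
                  (f-sym : ∀ a b → AbelianGroup._≈_ G (f a b) (f b a)) where
  open AbelianGroup G renaming (refl to ≈-refl; sym to ≈-sym; trans to ≈-trans)
  open AbelianGroupProperties G using (∙-cancelʳ)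
  open Index G f using (gSS; gSC; gCS; gCC; gTT)
  open Sums G
  open Values G f
  open SetoidReasoning setoid
  open CommutativeMonoidSolver commutativeMonoid using (solve; _⊜_; _⊕_; id)

  gᵃ : Act → Carrier
  gᵃ aSS = gSS
  gᵃ aSC = gSC
  gᵃ aCS = gCS
  gᵃ aCC = gCC
  gᵃ aTT = gTT

  private
    x∙y⁻¹∙y≈x : ∀ x y → (x ∙ y ⁻¹) ∙ y ≈ x
    x∙y⁻¹∙y≈x x y = ≈-trans (assoc _ _ _) (≈-trans (∙-congˡ (inverseˡ y)) (identityʳ x))

  gᵃ-pairs : ∀ b → gᵃ b ∙ Σᶠ (g⁻ b) ≈ Σᶠ (g⁺ b)
  gᵃ-pairs aSS = identityʳ _
  gᵃ-pairs aCC = identityʳ _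
  gᵃ-pairs aSC = ≈-trans (x∙y⁻¹∙y≈x _ _)
    (solve 3 (λ a b d → ((a ⊕ (a ⊕ (a ⊕ id))) ⊕ b) ⊕ d ⊜ a ⊕ (a ⊕ (a ⊕ (b ⊕ (d ⊕ id)))))
       ≈-refl (f 3 4) (f 2 4) (f 2 3))
  gᵃ-pairs aTT = ≈-trans (∙-congˡ (identityʳ _)) (≈-trans (x∙y⁻¹∙y≈x _ _)
    (solve 4 (λ a b d x → ((a ⊕ b) ⊕ d) ⊕ x ⊜ a ⊕ (b ⊕ (d ⊕ (x ⊕ id))))
       ≈-refl (f 2 3) (f 2 4) (f 3 4) (f 4 4)))
  gᵃ-pairs aCS = ≈-trans
    (solve 5 (λ a i d t b → (((a ⊕ i) ⊕ d) ⊕ (t ⊕ (t ⊕ id))) ⊕ (b ⊕ id)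
                          ⊜ (i ⊕ b) ⊕ (a ⊕ (d ⊕ (t ⊕ (t ⊕ id)))))
      ≈-refl (f 3 4) (f 2 4 ⁻¹) (f 2 3) (f 3 3) (f 2 4))
    (≈-trans (∙-congʳ (inverseˡ _)) (identityˡ _))

  TIof≡Σᶠ-degreePairs : ∀ X → TIof X ≡ Σᶠ (degreePairs X)
  TIof≡Σᶠ-degreePairs X = cong Σ' (ListP.map-∘ (edgesOf X))

  TIof-translate≡Σᶠ-degreePairs : ∀ Q X → TIof (map (translate Q) X) ≡ Σᶠ (degreePairs X)
  TIof-translate≡Σᶠ-degreePairs Q X = trans (TIof-translate G f Q X) (TIof≡Σᶠ-degreePairs X)

  increment-local : ∀ Z Y p x → All (λ z → ¬ SharePoint z p) Z →
    All (λ y → SharePoint y p → All (λ z → ¬ SharePoint z y) Z) Y →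
    TIof (Y ++ p ∷ []) ≈ TIof Y ∙ x → TIof ((Z ++ Y) ++ p ∷ []) ≈ TIof (Z ++ Y) ∙ x
  increment-local Z Y p x far shielded increment = ∙-cancelʳ (TIof Y) _ _ (begin
    TIof ((Z ++ Y) ++ p ∷ []) ∙ TIof Y  ≈⟨ locality Z Y p far shielded ⟩
    TIof (Z ++ Y) ∙ TIof (Y ++ p ∷ [])  ≈⟨ ∙-congˡ increment ⟩
    TIof (Z ++ Y) ∙ (TIof Y ∙ x)        ≈⟨ solve 3 (λ a b c → a ⊕ (b ⊕ c) ⊜ (a ⊕ c) ⊕ b) ≈-refl _ _ x ⟩
    (TIof (Z ++ Y) ∙ x) ∙ TIof Y ∎)

  increment-window : ∀ ph k W Q b → T (localChange? (local ph k W) b) →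
    let d = proj₁ (move ph (linkType b)) in
    TIof ((map (translate Q) W ++ Q ∷ []) ++ step d Q ∷ []) ≈ TIof (map (translate Q) W ++ Q ∷ []) ∙ gᵃ b
  increment-window ph k W Q b check = ∙-cancelʳ (Σᶠ (g⁻ b)) _ _ (begin
    TIof (Y ++ p ∷ []) ∙ Σᶠ (g⁻ b)
      ≡⟨ cong (λ t → TIof t ∙ Σᶠ (g⁻ b)) (absolute-window-∷ʳ Q W d) ⟩
    TIof (map (translate Q) W⁺⁺) ∙ Σᶠ (g⁻ b)
      ≡⟨ cong (_∙ Σᶠ (g⁻ b)) (TIof-translate≡Σᶠ-degreePairs Q W⁺⁺) ⟩
    Σᶠ (degreePairs W⁺⁺) ∙ Σᶠ (g⁻ b)
      ≈⟨ ≈-sym (Σ'-++ (uncurry f) (degreePairs W⁺⁺) (g⁻ b)) ⟩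
    Σᶠ (degreePairs W⁺⁺ ++ g⁻ b)
      ≈⟨ Σ'-sameBagOfUnorderedPairs f f-sym (degreePairs W⁺⁺ ++ g⁻ b) (degreePairs W⁺ ++ g⁺ b) check ⟩
    Σᶠ (degreePairs W⁺ ++ g⁺ b)
      ≈⟨ Σ'-++ (uncurry f) (degreePairs W⁺) (g⁺ b) ⟩
    Σᶠ (degreePairs W⁺) ∙ Σᶠ (g⁺ b)
      ≈⟨ ∙-congˡ (≈-sym (gᵃ-pairs b)) ⟩
    Σᶠ (degreePairs W⁺) ∙ (gᵃ b ∙ Σᶠ (g⁻ b))
      ≈⟨ ≈-sym (assoc _ _ _) ⟩
    (Σᶠ (degreePairs W⁺) ∙ gᵃ b) ∙ Σᶠ (g⁻ b)
      ≡⟨ cong (λ t → (t ∙ gᵃ b) ∙ Σᶠ (g⁻ b)) (sym (TIof-translate≡Σᶠ-degreePairs Q W⁺)) ⟩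
    (TIof (map (translate Q) W⁺) ∙ gᵃ b) ∙ Σᶠ (g⁻ b)
      ≡⟨ cong (λ t → (TIof t ∙ gᵃ b) ∙ Σᶠ (g⁻ b)) (sym (absolute-window Q W)) ⟩
    (TIof Y ∙ gᵃ b) ∙ Σᶠ (g⁻ b) ∎)
    where
    d = proj₁ (move ph (linkType b))
    p = step d Q
    Y = map (translate Q) W ++ Q ∷ []
    W⁺ = W ++ origin ∷ []
    W⁺⁺ = W ++ origin ∷ unitVector d ∷ []

  TIof-extend : ∀ {ds done ph Q W} (B : Built ds done ph Q W) k b → T (localChange? (local ph k W) b) →
    let d = proj₁ (move ph (linkType b)) in
    PairwiseSeparated (cells (ds ++ d ∷ [])) → TIof (cells (ds ++ d ∷ [])) ≈ TIof (cells ds) ∙ gᵃ b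
  TIof-extend {ds} {ph = ph} {Q} {W} B k b check separated′ = begin
    TIof (cells (ds ++ d ∷ []))      ≡⟨ cong TIof (trans (cells-extend B b) (cong (_++ p ∷ []) reassoc)) ⟩
    TIof ((Z ++ Y) ++ p ∷ [])
      ≈⟨ increment-local Z Y p (gᵃ b) far shielded (increment-window ph k W Q b check) ⟩
    TIof (Z ++ Y) ∙ gᵃ b             ≡⟨ cong (λ X → TIof X ∙ gᵃ b) (sym (trans cells≡ reassoc)) ⟩
    TIof (cells ds) ∙ gᵃ b ∎
    where
    open Built B using (cells≡; window)
    d = proj₁ (move ph (linkType b))
    p = step d Q
    Z = Built.far B
    Y = map (translate Q) W ++ Q ∷ []
    reassoc : (Z ++ map (translate Q) W) ++ Q ∷ [] ≡ Z ++ Y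
    reassoc = ListP.++-assoc Z (map (translate Q) W) (Q ∷ [])
    shielding′ = shielding window Q p (subst PairwiseSeparated (cells-extend B b) separated′)
    far = proj₁ shielding′
    shielded = proj₂ shielding′

Admissible : Phase → Kind → List Act → Set
Admissible ph k [] = ⊤
Admissible ph k (b ∷ bs) = T (admissible? ph k b) × Admissible (proj₂ (move ph (linkType b))) (kindAfter b) bs

module Construction {c ℓ : Level} (G : AbelianGroup c ℓ) (f : ℕ → ℕ → AbelianGroup.Carrier G)
                    (f-sym : ∀ a b → AbelianGroup._≈_ G (f a b) (f b a)) where
  open AbelianGroup G renaming (refl to ≈-refl; sym to ≈-sym; trans to ≈-trans)
  open Index G f using (g; c₁; TIcompressed; gCS; gTT)
  open Sums G
  open Values G f
  open Increments G f f-sym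
  open SetoidReasoning setoid
  open CommutativeMonoidSolver commutativeMonoid using (solve; _⊜_; _⊕_; id)

  Realized : List Act → Carrier → Set ℓ
  Realized bs v = Σ (List Dir) λ ds →
    linksAux [] R ds ≡ map link bs × PairwiseSeparated (cells ds) × TIof (cells ds) ≈ v

  Realized-≈ : ∀ bs {v v'} → Realized bs v → v ≈ v' → Realized bs v'
  Realized-≈ bs (ds , links≡ , separated , value) v≈v' = ds , links≡ , separated , ≈-trans value v≈v'

  realize-from : ∀ bs {ds done ph k Q W} → Built ds done ph Q W → local ph k W ∈ reachable →
    Admissible ph k bs → Realized (done ++ bs) (TIof (cells ds) ∙ Σ' (map gᵃ bs))
  realize-from [] {ds} {done} B _ _ =
    ds , trans (Built.links≡ B) (cong (map link) (sym (ListP.++-identityʳ done))) , Built.separated B ,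
    ≈-sym (identityʳ _)
  realize-from (b ∷ bs) {ds} {done} {ph} {k} B s∈ (ok , oks) =
    subst (λ bs′ → Realized bs′ (TIof (cells ds) ∙ Σ' (map gᵃ (b ∷ bs)))) (ListP.++-assoc done (b ∷ []) bs)
      (Realized-≈ ((done ++ b ∷ []) ++ bs) (realize-from bs B′ (proj₁ reached) oks) (begin
        TIof (cells (ds ++ d ∷ [])) ∙ Σ' (map gᵃ bs)
          ≈⟨ ∙-congʳ (TIof-extend B k b (proj₂ reached) (Built.separated B′)) ⟩
        (TIof (cells ds) ∙ gᵃ b) ∙ Σ' (map gᵃ bs)
          ≈⟨ assoc _ _ _ ⟩
        TIof (cells ds) ∙ Σ' (map gᵃ (b ∷ bs)) ∎))
    where
    d = proj₁ (move ph (linkType b))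
    B′ = extend B b (proj₂ (Equivalence.to (T-∧ {admits k b}) ok))
    reached = reachable-step s∈ b ok

  g≈Σgᵃ-expand1 : ∀ a → g a ≈ Σ' (map gᵃ (expand1 a))
  g≈Σgᵃ-expand1 SS = ≈-sym (identityʳ _)
  g≈Σgᵃ-expand1 SC = ≈-sym (identityʳ _)
  g≈Σgᵃ-expand1 CS = ≈-sym (identityʳ _)
  g≈Σgᵃ-expand1 CC = ≈-sym (identityʳ _)
  g≈Σgᵃ-expand1 ST = solve 3 (λ a b c → (a ⊕ b) ⊕ c ⊜ a ⊕ (b ⊕ (c ⊕ id))) ≈-refl _ _ _
  g≈Σgᵃ-expand1 CT = solve 3 (λ a b c → (a ⊕ b) ⊕ c ⊜ a ⊕ (b ⊕ (c ⊕ id))) ≈-refl _ _ _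

  Σg≈Σgᵃ-expand : ∀ as → Σ' (map g as) ≈ Σ' (map gᵃ (expand as))
  Σg≈Σgᵃ-expand [] = ≈-refl
  Σg≈Σgᵃ-expand (a ∷ as) =
    ≈-trans (∙-cong (g≈Σgᵃ-expand1 a) (Σg≈Σgᵃ-expand as)) (≈-sym (Σ'-++ gᵃ (expand1 a) (expand as)))

  -- The degree pairs of the first three squares, straight or bent.
  straight-pairs bent-pairs : List Pair
  straight-pairs = (2 , 2) ∷ (2 , 2) ∷ (2 , 3) ∷ (2 , 3) ∷ (2 , 3) ∷ (2 , 3) ∷ (3 , 3) ∷ (3 , 3) ∷ (3 , 3) ∷ (3 , 3) ∷ []
  bent-pairs = (2 , 2) ∷ (2 , 2) ∷ (2 , 3) ∷ (2 , 3) ∷ (2 , 3) ∷ (2 , 3) ∷ (3 , 4) ∷ (3 , 4) ∷ (2 , 4) ∷ (2 , 4) ∷ []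

  TIof-straight : TIof (cells (R ∷ [])) ≈ c₁ SS
  TIof-straight = begin
    TIof (cells (R ∷ []))
      ≡⟨ TIof≡Σᶠ-degreePairs (cells (R ∷ [])) ⟩
    Σᶠ (degreePairs (cells (R ∷ [])))
      ≈⟨ Σ'-sameBagOfUnorderedPairs f f-sym (degreePairs (cells (R ∷ []))) straight-pairs _ ⟩
    Σᶠ straight-pairs
      ≈⟨ solve 3 (λ a b d → a ⊕ (a ⊕ (b ⊕ (b ⊕ (b ⊕ (b ⊕ (d ⊕ (d ⊕ (d ⊕ (d ⊕ id)))))))))
                          ⊜ ((a ⊕ (a ⊕ id)) ⊕ (b ⊕ (b ⊕ (b ⊕ (b ⊕ id))))) ⊕ (d ⊕ (d ⊕ (d ⊕ (d ⊕ id)))))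
                 ≈-refl (f 2 2) (f 2 3) (f 3 3) ⟩
    c₁ SS ∎

  TIof-bent : TIof (cells (U ∷ [])) ≈ c₁ SC
  TIof-bent = begin
    TIof (cells (U ∷ []))
      ≡⟨ TIof≡Σᶠ-degreePairs (cells (U ∷ [])) ⟩
    Σᶠ (degreePairs (cells (U ∷ [])))
      ≈⟨ Σ'-sameBagOfUnorderedPairs f f-sym (degreePairs (cells (U ∷ []))) bent-pairs _ ⟩
    Σᶠ bent-pairs
      ≈⟨ solve 4 (λ a b d x → a ⊕ (a ⊕ (b ⊕ (b ⊕ (b ⊕ (b ⊕ (d ⊕ (d ⊕ (x ⊕ (x ⊕ id)))))))))
                            ⊜ (((a ⊕ (a ⊕ id)) ⊕ (b ⊕ (b ⊕ (b ⊕ (b ⊕ id))))) ⊕ (d ⊕ (d ⊕ id))) ⊕ (x ⊕ (x ⊕ id)))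
                 ≈-refl (f 2 2) (f 2 3) (f 3 4) (f 2 4) ⟩
    c₁ SC ∎

  -- The local states after a first action SS or SC are the first two entries of `reachable`.
  realize : ∀ a₁ as → first a₁ ≡ S → Admissible (horizontal rightward) afterS (expand (a₁ ∷ as)) →
    Realized (expand (a₁ ∷ as)) (TIcompressed (a₁ ∷ as))
  realize SS as _ (_ , oks) =
    Realized-≈ (expand (SS ∷ as)) (realize-from (expand as) (extend built₀ aSS _) (here refl) oks)
      (∙-cong TIof-straight (≈-sym (Σg≈Σgᵃ-expand as)))
  realize SC as _ (_ , oks) =
    Realized-≈ (expand (SC ∷ as)) (realize-from (expand as) (extend built₀ aSC _) (there (here refl)) oks)
      (∙-cong TIof-bent (≈-sym (Σg≈Σgᵃ-expand as)))
  realize ST as _ (_ , oks) =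
    Realized-≈ (expand (ST ∷ as)) (realize-from (aCS ∷ aTT ∷ expand as) (extend built₀ aSC _) (there (here refl)) oks)
      (begin
        TIof (cells (U ∷ [])) ∙ (gCS ∙ (gTT ∙ Σ' (map gᵃ (expand as))))
          ≈⟨ ∙-cong TIof-bent (∙-congˡ (∙-congˡ (≈-sym (Σg≈Σgᵃ-expand as)))) ⟩
        c₁ SC ∙ (gCS ∙ (gTT ∙ Σ' (map g as)))
          ≈⟨ solve 4 (λ a b c d → a ⊕ (b ⊕ (c ⊕ d)) ⊜ ((a ⊕ b) ⊕ c) ⊕ d) ≈-refl _ _ _ _ ⟩
        TIcompressed (ST ∷ as) ∎)

-- Algorithm 1

-- The second letter with T identified with C: an ST or CT action also ends in a turn.
turn : CAct → Letter
turn SS = S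
turn CS = S
turn SC = C
turn CC = C
turn ST = C
turn CT = C

shape : CAct → Letter × Letter
shape a = first a , turn a

Follows⇒≡turn : ∀ a b → Follows a b → first b ≡ turn a
Follows⇒≡turn SS b fo = fo
Follows⇒≡turn CS b fo = fo
Follows⇒≡turn SC b fo = fo
Follows⇒≡turn CC b fo = fo
Follows⇒≡turn ST b fo = fo
Follows⇒≡turn CT b fo = fo

≡turn⇒Follows : ∀ a b → first b ≡ turn a → Follows a b
≡turn⇒Follows SS b eq = eq
≡turn⇒Follows CS b eq = eq
≡turn⇒Follows SC b eq = eq
≡turn⇒Follows CC b eq = eq
≡turn⇒Follows ST b eq = eq
≡turn⇒Follows CT b eq = eq

ChainOK-shape : ∀ a as a' as' → shape a ≡ shape a' → map shape as ≡ map shape as' → ChainOK a as → ChainOK a' as'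
ChainOK-shape a [] a' [] _ _ _ = tt
ChainOK-shape a (b ∷ bs) a' (b' ∷ bs') a≈a' bbs≈ (fo , ok) =
  ≡turn⇒Follows a' b' (trans (sym (cong proj₁ b≈b')) (trans (Follows⇒≡turn a b fo) (cong proj₂ a≈a'))) ,
  ChainOK-shape b bs b' bs' b≈b' (ListP.∷-injectiveʳ bbs≈) ok
  where b≈b' = ListP.∷-injectiveˡ bbs≈

ValidCompressed-shape : ∀ as as' → map shape as ≡ map shape as' → ValidCompressed as → ValidCompressed as'
ValidCompressed-shape (a ∷ as) (a' ∷ as') eq (firstS , ok) =
  trans (sym (cong proj₁ (ListP.∷-injectiveˡ eq))) firstS ,
  ChainOK-shape a as a' as' (ListP.∷-injectiveˡ eq) (ListP.∷-injectiveʳ eq) ok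

incSum : List CAct → ℕ
incSum = sum ∘ map inc

odd-+1 : ∀ m → odd (m + 1) ≡ not (odd m)
odd-+1 m = cong odd (ℕP.+-comm m 1)

odd-+2 : ∀ m → odd (m + 2) ≡ odd m
odd-+2 m = trans (cong odd (ℕP.+-comm m 2)) (BoolP.not-involutive (odd m))

odd-+0 : ∀ m → odd (m + 0) ≡ odd m
odd-+0 m = cong odd (ℕP.+-identityʳ m)

-- On the accumulator of algorithm 1, whose latest action comes first.
EvenBeforeT : List CAct → Set
EvenBeforeT [] = ⊤
EvenBeforeT (a ∷ acc) = (isT a ≡ true → odd (incSum acc) ≡ false) × EvenBeforeT acc

LastTurnIsC : List CAct → Set
LastTurnIsC [] = ⊥
LastTurnIsC (SS ∷ acc) = LastTurnIsC acc
LastTurnIsC (CS ∷ acc) = LastTurnIsC acc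
LastTurnIsC (SC ∷ acc) = ⊤
LastTurnIsC (CC ∷ acc) = ⊤
LastTurnIsC (ST ∷ acc) = ⊥
LastTurnIsC (CT ∷ acc) = ⊥

not≡true : ∀ b → not b ≡ true → b ≡ false
not≡true false _ = refl

record Swapped (acc acc' : List CAct) : Set where
  field
    incSum-suc : incSum acc' ≡ suc (incSum acc)
    evenBeforeT : EvenBeforeT acc'
    shape≡ : map shape acc' ≡ map shape acc

swapLastC-spec : ∀ acc → LastTurnIsC acc → odd (incSum acc) ≡ true → EvenBeforeT acc →
  Σ (List CAct) λ acc' → swapLastC acc ≡ just acc' × Swapped acc acc'
swapLastC-spec (SC ∷ acc) _ odd-sum (_ , ev) = ST ∷ acc , refl , record
  { incSum-suc = refl ; evenBeforeT = (λ _ → not≡true _ odd-sum) , ev ; shape≡ = refl }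
swapLastC-spec (CC ∷ acc) _ odd-sum (_ , ev) = CT ∷ acc , refl , record
  { incSum-suc = refl ; evenBeforeT = (λ _ → not≡true _ odd-sum) , ev ; shape≡ = refl }
swapLastC-spec (SS ∷ acc) last odd-sum (_ , ev)
  with acc' , swapped , s ← swapLastC-spec acc last odd-sum ev rewrite swapped =
  SS ∷ acc' , refl , record
  { incSum-suc = Swapped.incSum-suc s
  ; evenBeforeT = (λ ()) , Swapped.evenBeforeT s
  ; shape≡ = cong (shape SS ∷_) (Swapped.shape≡ s)
  }
swapLastC-spec (CS ∷ acc) last odd-sum (_ , ev)
  with acc' , swapped , s ← swapLastC-spec acc last odd-sum ev rewrite swapped =
  CS ∷ acc' , refl , record
  { incSum-suc = Swapped.incSum-suc s
  ; evenBeforeT = (λ ()) , Swapped.evenBeforeT s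
  ; shape≡ = cong (shape CS ∷_) (Swapped.shape≡ s)
  }

record Alg1Invariant (m : ℕ) (acc : List CAct) : Set where
  field
    incSum≡ : incSum acc ≡ m
    evenBeforeT : EvenBeforeT acc
    lastTurn : odd m ≡ true → LastTurnIsC acc

record TtoC (a : CAct) : Set where
  field
    inc≡2 : inc a ≡ 2
    inc-toC≡1 : inc (toC a) ≡ 1
    shape-toC : shape (toC a) ≡ shape a
    ¬isT-toC : isT (toC a) ≡ false
    lastTurn-toC : ∀ acc → LastTurnIsC (toC a ∷ acc)

isT⇒TtoC : ∀ a → isT a ≡ true → TtoC a
isT⇒TtoC ST _ = record { inc≡2 = refl ; inc-toC≡1 = refl ; shape-toC = refl ; ¬isT-toC = refl ; lastTurn-toC = λ _ → tt }
isT⇒TtoC CT _ = record { inc≡2 = refl ; inc-toC≡1 = refl ; shape-toC = refl ; ¬isT-toC = refl ; lastTurn-toC = λ _ → tt }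

∧≡false : ∀ a b → a ∧ b ≡ false → a ≡ true → b ≡ false
∧≡false true b eq _ = eq

∧≡true : ∀ a b → a ∧ b ≡ true → a ≡ true × b ≡ true
∧≡true true true _ = refl , refl

push-invariant : ∀ m acc a → Alg1Invariant m acc → isT a ∧ odd (m + inc a) ≡ false → Alg1Invariant (m + inc a) (a ∷ acc)
push-invariant m acc a inv no-swap = record
  { incSum≡ = trans (ℕP.+-comm (inc a) (incSum acc)) (cong (λ n → n + inc a) incSum≡)
  ; evenBeforeT = evenT , evenBeforeT
  ; lastTurn = lastTurn′ a no-swap
  }
  where
  open Alg1Invariant inv
  evenT : isT a ≡ true → odd (incSum acc) ≡ false
  evenT t = trans (cong odd incSum≡)
    (trans (sym (odd-+2 m)) (trans (cong (λ k → odd (m + k)) (sym (TtoC.inc≡2 (isT⇒TtoC a t)))) (∧≡false _ _ no-swap t)))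
  lastTurn′ : ∀ a → isT a ∧ odd (m + inc a) ≡ false → odd (m + inc a) ≡ true → LastTurnIsC (a ∷ acc)
  lastTurn′ SS _ odd-m = lastTurn (trans (sym (odd-+0 m)) odd-m)
  lastTurn′ CS _ odd-m = lastTurn (trans (sym (odd-+0 m)) odd-m)
  lastTurn′ SC _ _ = tt
  lastTurn′ CC _ _ = tt
  lastTurn′ ST no-swap odd-m with () ← trans (sym no-swap) odd-m
  lastTurn′ CT no-swap odd-m with () ← trans (sym no-swap) odd-m

ʳ++-shape : ∀ as xs ys → map shape xs ≡ map shape ys → map shape (as ʳ++ xs) ≡ map shape (as ʳ++ ys)
ʳ++-shape [] xs ys eq = eq
ʳ++-shape (a ∷ as) xs ys eq = ʳ++-shape as (a ∷ xs) (a ∷ ys) (cong (shape a ∷_) eq)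

swap-invariant : ∀ m acc a acc' → Alg1Invariant m acc → isT a ≡ true → Swapped acc acc' →
  Alg1Invariant (m + inc a) (toC a ∷ acc')
swap-invariant m acc a acc' inv isT-a s = record
  { incSum≡ = begin
      inc (toC a) + incSum acc'
        ≡⟨ cong₂ _+_ (TtoC.inc-toC≡1 t) (trans (Swapped.incSum-suc s) (cong suc (Alg1Invariant.incSum≡ inv))) ⟩
      2 + m
        ≡⟨ ℕP.+-comm 2 m ⟩
      m + 2
        ≡⟨ cong (λ n → m + n) (sym (TtoC.inc≡2 t)) ⟩
      m + inc a ∎
  ; evenBeforeT = (λ isT-toC → ⊥-elim (false≢true (trans (sym (TtoC.¬isT-toC t)) isT-toC))) , Swapped.evenBeforeT s
  ; lastTurn = λ _ → TtoC.lastTurn-toC t acc'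
  }
  where
  open ≡-Reasoning
  t = isT⇒TtoC a isT-a
  false≢true : false ≢ true
  false≢true ()

-- A T arriving at an odd inc-sum finds a C as the latest turn (`lastTurn`), so the swap succeeds,
-- and the T it creates there sits at an even inc-sum.
alg1Aux-spec : ∀ as m acc → Alg1Invariant m acc →
  Σ (List CAct) λ accF → alg1Aux m acc as ≡ reverse accF × EvenBeforeT accF × map shape accF ≡ map shape (as ʳ++ acc)
alg1Aux-spec [] m acc inv = acc , refl , Alg1Invariant.evenBeforeT inv , refl
alg1Aux-spec (a ∷ as) m acc inv with isT a ∧ odd (m + inc a) in swap?
... | false = alg1Aux-spec as (m + inc a) (a ∷ acc) (push-invariant m acc a inv swap?)
... | true with isT-a , odd-m+inc ← ∧≡true _ _ swap?
  with odd-m ← trans (sym (odd-+2 m)) (trans (cong (λ k → odd (m + k)) (sym (TtoC.inc≡2 (isT⇒TtoC a isT-a)))) odd-m+inc)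
  with acc' , swapped , s ← swapLastC-spec acc (Alg1Invariant.lastTurn inv odd-m)
                                (trans (cong odd (Alg1Invariant.incSum≡ inv)) odd-m) (Alg1Invariant.evenBeforeT inv)
  rewrite swapped
  with accF , out , evenF , shapeF ← alg1Aux-spec as (m + inc a) (toC a ∷ acc') (swap-invariant m acc a acc' inv isT-a s) =
  accF , out , evenF ,
  trans shapeF (ʳ++-shape as (toC a ∷ acc') (a ∷ acc) (cong₂ _∷_ (TtoC.shape-toC (isT⇒TtoC a isT-a)) (Swapped.shape≡ s)))

EvenAtT : ℕ → List CAct → Set
EvenAtT m [] = ⊤
EvenAtT m (a ∷ as) = (isT a ≡ true → odd m ≡ false) × EvenAtT (m + inc a) as

EvenAtT-∷ʳ : ∀ m as a → EvenAtT m as → (isT a ≡ true → odd (m + incSum as) ≡ false) → EvenAtT m (as ++ a ∷ [])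
EvenAtT-∷ʳ m [] a _ even = (λ t → trans (sym (odd-+0 m)) (even t)) , tt
EvenAtT-∷ʳ m (b ∷ bs) a (evenb , evens) even =
  evenb , EvenAtT-∷ʳ (m + inc b) bs a evens (λ t → trans (cong odd (ℕP.+-assoc m (inc b) (incSum bs))) (even t))

incSum-reverse : ∀ as → incSum (reverse as) ≡ incSum as
incSum-reverse as = sum-↭ (map⁺ inc (↭-reverse as))

EvenBeforeT⇒EvenAtT : ∀ acc → EvenBeforeT acc → EvenAtT 0 (reverse acc)
EvenBeforeT⇒EvenAtT [] _ = tt
EvenBeforeT⇒EvenAtT (a ∷ acc) (even , evens) rewrite ListP.unfold-reverse a acc =
  EvenAtT-∷ʳ 0 (reverse acc) a (EvenBeforeT⇒EvenAtT acc evens) (λ t → trans (cong odd (incSum-reverse acc)) (even t))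

algorithm1-spec : ∀ as → ValidCompressed as → ValidCompressed (algorithm1 as) × EvenAtT 0 (algorithm1 as)
algorithm1-spec [] ()
algorithm1-spec as@(_ ∷ _) valid
  with accF , out , evenF , shapeF ← alg1Aux-spec as 0 [] (record { incSum≡ = refl ; evenBeforeT = tt ; lastTurn = λ () }) =
  ValidCompressed-shape as (algorithm1 as) (sym shape≡) valid , subst (EvenAtT 0) (sym out) (EvenBeforeT⇒EvenAtT accF evenF)
  where
  open ≡-Reasoning
  shape≡ : map shape (algorithm1 as) ≡ map shape as
  shape≡ = begin
    map shape (algorithm1 as)          ≡⟨ cong (map shape) out ⟩
    map shape (reverse accF)           ≡⟨ ListP.reverse-map shape accF ⟩
    reverse (map shape accF)           ≡⟨ cong reverse shapeF ⟩
    reverse (map shape (as ʳ++ []))    ≡⟨ cong (reverse ∘ map shape) (trans (ListP.ʳ++-defn as) (ListP.++-identityʳ _)) ⟩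
    reverse (map shape (reverse as))   ≡⟨ cong reverse (ListP.reverse-map shape as) ⟩
    reverse (reverse (map shape as))   ≡⟨ ListP.reverse-involutive _ ⟩
    map shape as ∎

PhaseParity : Phase → ℕ → Set
PhaseParity (horizontal σ) m = odd m ≡ false
PhaseParity (firstUp σ) m = odd m ≡ true
PhaseParity (up σ) m = odd m ≡ true

Accepts : Letter → Kind → Set
Accepts S k = k ≡ afterS ⊎ k ≡ afterCS
Accepts C k = k ≡ afterC
Accepts Letter.T k = ⊥

run : Phase → Kind → List Act → Phase × Kind
run ph k [] = ph , k
run ph k (b ∷ bs) = run (proj₂ (move ph (linkType b))) (kindAfter b) bs

Admissible-++ : ∀ ph k bs bs' → Admissible ph k bs → Admissible (proj₁ (run ph k bs)) (proj₂ (run ph k bs)) bs' →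
  Admissible ph k (bs ++ bs')
Admissible-++ ph k [] bs' _ ok = ok
Admissible-++ ph k (b ∷ bs) bs' (ok , oks) ok' = ok , Admissible-++ _ _ bs bs' oks ok'

private
  allowed-link₁ : ∀ ph → T (allowed ph link₁)
  allowed-link₁ (horizontal _) = _
  allowed-link₁ (firstUp _) = _
  allowed-link₁ (up _) = _

  allowed-link₂ : ∀ ph → T (allowed ph link₂)
  allowed-link₂ (horizontal _) = _
  allowed-link₂ (firstUp _) = _
  allowed-link₂ (up _) = _

  parity-link₁ : ∀ ph m → PhaseParity ph m → PhaseParity (proj₂ (move ph link₁)) (m + 0)
  parity-link₁ (horizontal _) m p = trans (odd-+0 m) p
  parity-link₁ (firstUp _) m p = trans (odd-+0 m) p
  parity-link₁ (up _) m p = trans (odd-+0 m) p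

  parity-link₂ : ∀ ph m → PhaseParity ph m → PhaseParity (proj₂ (move ph link₂)) (m + 1)
  parity-link₂ (horizontal _) m p = trans (odd-+1 m) (cong not p)
  parity-link₂ (firstUp _) m p = trans (odd-+1 m) (cong not p)
  parity-link₂ (up _) m p = trans (odd-+1 m) (cong not p)

  even⇒horizontal : ∀ ph m → PhaseParity ph m → odd m ≡ false → Σ Heading λ σ → ph ≡ horizontal σ
  even⇒horizontal (horizontal σ) m _ _ = σ , refl
  even⇒horizontal (firstUp σ) m odd-m even-m with () ← trans (sym odd-m) even-m
  even⇒horizontal (up σ) m odd-m even-m with () ← trans (sym odd-m) even-m

expand1-admissible : ∀ a ph k m → Accepts (first a) k → PhaseParity ph m → (isT a ≡ true → odd m ≡ false) →
  Admissible ph k (expand1 a)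
  × PhaseParity (proj₁ (run ph k (expand1 a))) (m + inc a) × Accepts (turn a) (proj₂ (run ph k (expand1 a)))
expand1-admissible SS ph .afterS  m (inj₁ refl) p _ = (allowed-link₁ ph , tt) , parity-link₁ ph m p , inj₁ refl
expand1-admissible SS ph .afterCS m (inj₂ refl) p _ = (allowed-link₁ ph , tt) , parity-link₁ ph m p , inj₁ refl
expand1-admissible SC ph .afterS  m (inj₁ refl) p _ = (allowed-link₂ ph , tt) , parity-link₂ ph m p , refl
expand1-admissible SC ph .afterCS m (inj₂ refl) p _ = (allowed-link₂ ph , tt) , parity-link₂ ph m p , refl
expand1-admissible CS ph .afterC  m refl p _ = (allowed-link₁ ph , tt) , parity-link₁ ph m p , inj₂ refl
expand1-admissible CC ph .afterC  m refl p _ = (allowed-link₂ ph , tt) , parity-link₂ ph m p , refl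
expand1-admissible ST ph k m acc p even with σ , refl ← even⇒horizontal ph m p (even refl) with acc
... | inj₁ refl = (_ , _ , _ , tt) , trans (odd-+2 m) p , refl
... | inj₂ refl = (_ , _ , _ , tt) , trans (odd-+2 m) p , refl
expand1-admissible CT ph .afterC m refl p even with σ , refl ← even⇒horizontal ph m p (even refl) =
  (_ , _ , _ , tt) , trans (odd-+2 m) p , refl

expand-admissible : ∀ a as ph k m → Accepts (first a) k → PhaseParity ph m → EvenAtT m (a ∷ as) → ChainOK a as →
  Admissible ph k (expand (a ∷ as))
expand-admissible a as ph k m acc p (even , evens) chain
  with ok , p′ , acc′ ← expand1-admissible a ph k m acc p even = Admissible-++ ph k (expand1 a) (expand as) ok (rest as evens chain)
  where
  rest : ∀ as → EvenAtT (m + inc a) as → ChainOK a as → Admissible _ _ (expand as)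
  rest [] _ _ = tt
  rest (b ∷ bs) evens (follows , chain) =
    expand-admissible b bs _ _ (m + inc a) (subst (λ ℓ → Accepts ℓ _) (sym (Follows⇒≡turn a b follows)) acc′) p′ evens chain

algorithm1-admissible : ∀ as → ValidCompressed as → EvenAtT 0 as → Admissible (horizontal rightward) afterS (expand as)
algorithm1-admissible (a ∷ as) (firstS , chain) even =
  expand-admissible a as (horizontal rightward) afterS 0 (subst (λ ℓ → Accepts ℓ afterS) (sym firstS) (inj₁ refl)) refl even chain

OldestS : List Letter → Set
OldestS [] = ⊤
OldestS (x ∷ []) = x ≡ S
OldestS (_ ∷ y ∷ ys) = OldestS (y ∷ ys)

OldestS-∷ : ∀ x xs → OldestS xs → (xs ≡ [] → x ≡ S) → OldestS (x ∷ xs)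
OldestS-∷ x [] _ x≡S = x≡S refl
OldestS-∷ x (y ∷ ys) oldest _ = oldest

OldestS-tail : ∀ x xs → OldestS (x ∷ xs) → OldestS xs
OldestS-tail x [] _ = tt
OldestS-tail x (y ∷ ys) oldest = oldest

map-≡[] : ∀ {A B : Set} (h : A → B) xs → map h xs ≡ [] → xs ≡ []
map-≡[] h [] _ = refl

map-≢[] : ∀ {A B : Set} (h : A → B) {xs ys} → map h xs ≡ map h ys → ys ≢ [] → xs ≢ []
map-≢[] h {ys = ys} eq ys≢[] refl = ys≢[] (map-≡[] h ys (sym eq))

module AlgorithmOneValue {c ℓ : Level} (G : AbelianGroup c ℓ) (f : ℕ → ℕ → AbelianGroup.Carrier G) where
  open AbelianGroup G renaming (refl to ≈-refl; sym to ≈-sym; trans to ≈-trans)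
  open Index G f using (g; c₁; TIcompressed; gCS; gTT)
  open Sums G
  open SetoidReasoning setoid
  open CommutativeMonoidSolver commutativeMonoid using (solve; _⊜_; _⊕_; id)

  valueʳ : List CAct → Carrier
  valueʳ [] = ε
  valueʳ (a ∷ []) = c₁ a
  valueʳ (a ∷ b ∷ acc) = g a ∙ valueʳ (b ∷ acc)

  valueʳ-∷ : ∀ a acc → acc ≢ [] → valueʳ (a ∷ acc) ≡ g a ∙ valueʳ acc
  valueʳ-∷ a [] nonempty = ⊥-elim (nonempty refl)
  valueʳ-∷ a (_ ∷ _) _ = refl

  TIcompressed-reverse : ∀ acc → TIcompressed (reverse acc) ≈ valueʳ acc
  TIcompressed-reverse [] = ≈-refl
  TIcompressed-reverse (a ∷ []) = identityʳ _
  TIcompressed-reverse (a ∷ b ∷ acc) with reverse (b ∷ acc) in rev | TIcompressed-reverse (b ∷ acc)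
  ... | [] | _ with () ← trans (sym (ListP.length-reverse (b ∷ acc))) (cong Data.List.length rev)
  ... | y ∷ ys | ih = begin
    TIcompressed (reverse (a ∷ b ∷ acc))
      ≡⟨ cong TIcompressed (trans (ListP.unfold-reverse a (b ∷ acc)) (cong (_++ a ∷ []) rev)) ⟩
    c₁ y ∙ Σ' (map g (ys ++ a ∷ []))
      ≈⟨ ∙-congˡ (Σ'-++ g ys (a ∷ [])) ⟩
    c₁ y ∙ (Σ' (map g ys) ∙ (g a ∙ ε))
      ≈⟨ solve 3 (λ x s ga → x ⊕ (s ⊕ (ga ⊕ id)) ⊜ ga ⊕ (x ⊕ s)) ≈-refl (c₁ y) _ (g a) ⟩
    g a ∙ TIcompressed (y ∷ ys)
      ≈⟨ ∙-congˡ ih ⟩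
    g a ∙ valueʳ (b ∷ acc) ∎

  -- The value of the T-part of an ST or CT action.
  ΔT : Carrier
  ΔT = gCS ∙ gTT

  g-toT : ∀ a → isC a ≡ true → g (toT a) ≈ g a ∙ ΔT
  g-toT SC _ = assoc _ _ _
  g-toT CC _ = assoc _ _ _

  g-toC : ∀ a → isT a ≡ true → g a ≈ g (toC a) ∙ ΔT
  g-toC ST _ = assoc _ _ _
  g-toC CT _ = assoc _ _ _

  first-toT : ∀ a → isC a ≡ true → first (toT a) ≡ first a
  first-toT SC _ = refl
  first-toT CC _ = refl

  valueʳ-toT : ∀ a acc → isC a ≡ true → OldestS (map first (a ∷ acc)) → valueʳ (toT a ∷ acc) ≈ valueʳ (a ∷ acc) ∙ ΔT
  valueʳ-toT SC [] _ _ = assoc _ _ _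
  valueʳ-toT a (b ∷ acc) isC-a _ =
    ≈-trans (∙-congʳ (g-toT a isC-a)) (solve 3 (λ x d v → (x ⊕ d) ⊕ v ⊜ (x ⊕ v) ⊕ d) ≈-refl (g a) ΔT _)

  swapLastC-value : ∀ acc {acc'} → OldestS (map first acc) → swapLastC acc ≡ just acc' →
    valueʳ acc' ≈ valueʳ acc ∙ ΔT × map first acc' ≡ map first acc
  swapLastC-value (a ∷ acc) oldest swapped with isC a in isC-a
  swapLastC-value (a ∷ acc) oldest refl | true = valueʳ-toT a acc isC-a oldest , cong (_∷ map first acc) (first-toT a isC-a)
  ... | false with swapLastC acc in swapped′
  swapLastC-value (a ∷ acc) oldest refl | false | just acc′ =
    (begin
      valueʳ (a ∷ acc′)        ≡⟨ valueʳ-∷ a acc′ (map-≢[] first first≡ acc≢[]) ⟩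
      g a ∙ valueʳ acc′        ≈⟨ ∙-congˡ value ⟩
      g a ∙ (valueʳ acc ∙ ΔT)  ≈⟨ ≈-sym (assoc _ _ _) ⟩
      (g a ∙ valueʳ acc) ∙ ΔT  ≡⟨ cong (_∙ ΔT) (sym (valueʳ-∷ a acc acc≢[])) ⟩
      valueʳ (a ∷ acc) ∙ ΔT ∎) ,
    cong (first a ∷_) first≡
    where
    acc≢[] : acc ≢ []
    acc≢[] acc≡[] with () ← trans (cong swapLastC (sym acc≡[])) swapped′
    rec = swapLastC-value acc (OldestS-tail (first a) (map first acc) oldest) swapped′
    value = proj₁ rec
    first≡ = proj₂ rec

  valueʳ-ʳ++ : ∀ as x X y Y → valueʳ (x ∷ X) ≈ valueʳ (y ∷ Y) → valueʳ (as ʳ++ (x ∷ X)) ≈ valueʳ (as ʳ++ (y ∷ Y))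
  valueʳ-ʳ++ [] x X y Y eq = eq
  valueʳ-ʳ++ (a ∷ as) x X y Y eq = valueʳ-ʳ++ as a (x ∷ X) a (y ∷ Y) (∙-congˡ eq)

  -- The swap at j adds ΔT and the one at i removes it.
  valueʳ-swap : ∀ a acc acc' → acc ≢ [] → isT a ≡ true →
    valueʳ acc' ≈ valueʳ acc ∙ ΔT → map first acc' ≡ map first acc → valueʳ (toC a ∷ acc') ≈ valueʳ (a ∷ acc)
  valueʳ-swap a acc acc' acc≢[] isT-a value first≡ = begin
    valueʳ (toC a ∷ acc')         ≡⟨ valueʳ-∷ (toC a) acc' (map-≢[] first first≡ acc≢[]) ⟩
    g (toC a) ∙ valueʳ acc'       ≈⟨ ∙-congˡ value ⟩
    g (toC a) ∙ (valueʳ acc ∙ ΔT) ≈⟨ solve 3 (λ x v d → x ⊕ (v ⊕ d) ⊜ (x ⊕ d) ⊕ v) ≈-refl (g (toC a)) _ ΔT ⟩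
    (g (toC a) ∙ ΔT) ∙ valueʳ acc ≈⟨ ∙-congʳ (≈-sym (g-toC a isT-a)) ⟩
    g a ∙ valueʳ acc              ≡⟨ sym (valueʳ-∷ a acc acc≢[]) ⟩
    valueʳ (a ∷ acc) ∎

  FirstIsS : List CAct → Set
  FirstIsS [] = ⊤
  FirstIsS (a ∷ _) = first a ≡ S

  alg1Aux-value : ∀ as m acc → OldestS (map first acc) → (acc ≡ [] → FirstIsS as) →
    TIcompressed (alg1Aux m acc as) ≈ valueʳ (as ʳ++ acc)
  alg1Aux-value [] m acc _ _ = TIcompressed-reverse acc
  alg1Aux-value (a ∷ as) m acc oldest firstS with isT a ∧ odd (m + inc a) in swap?
  ... | false = alg1Aux-value as _ (a ∷ acc) (OldestS-∷ (first a) _ oldest (firstS ∘ map-≡[] first acc)) (λ ())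
  ... | true with swapLastC acc in swapped
  ...   | nothing = alg1Aux-value as _ (a ∷ acc) (OldestS-∷ (first a) _ oldest (firstS ∘ map-≡[] first acc)) (λ ())
  ...   | just acc' with value , first≡ ← swapLastC-value acc oldest swapped =
    ≈-trans (alg1Aux-value as _ (toC a ∷ acc') oldest′ (λ ()))
            (valueʳ-ʳ++ as (toC a) acc' a acc (valueʳ-swap a acc acc' acc≢[] (proj₁ (∧≡true _ _ swap?)) value first≡))
    where
    acc≢[] : acc ≢ []
    acc≢[] acc≡[] with () ← trans (cong swapLastC (sym acc≡[])) swapped
    oldest′ : OldestS (map first (toC a ∷ acc'))
    oldest′ = OldestS-∷ _ _ (subst OldestS (sym first≡) oldest)
                (λ acc'≡[] → ⊥-elim (map-≢[] first first≡ acc≢[] (map-≡[] first acc' acc'≡[])))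

  algorithm1-value : ∀ as → ValidCompressed as → TIcompressed (algorithm1 as) ≈ TIcompressed as
  algorithm1-value [] ()
  algorithm1-value as@(a ∷ _) (firstS , _) = begin
    TIcompressed (algorithm1 as)     ≈⟨ alg1Aux-value as 0 [] tt (λ _ → firstS) ⟩
    valueʳ (as ʳ++ [])               ≡⟨ cong valueʳ (trans (ListP.ʳ++-defn as) (ListP.++-identityʳ _)) ⟩
    valueʳ (reverse as)              ≈⟨ ≈-sym (TIcompressed-reverse (reverse as)) ⟩
    TIcompressed (reverse (reverse as)) ≡⟨ cong TIcompressed (ListP.reverse-involutive as) ⟩
    TIcompressed as ∎

theorem4p1 : ∀ {c ℓ} (G : AbelianGroup c ℓ) (f : ℕ → ℕ → AbelianGroup.Carrier G) →
    (∀ a b → AbelianGroup._≈_ G (f a b) (f b a)) →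
    (as : List CAct) → ValidCompressed as →
    Σ (List Dir) (λ ds →
      (links ds ≡ algorithm2 (expand (algorithm1 as)))
      × GeneralPolyominoChain ds
      × AbelianGroup._≈_ G (Index.TIchain G f ds) (Index.TIcompressed G f as))
theorem4p1 G f f-sym as valid
  with algorithm1 as | algorithm1-spec as valid | AlgorithmOneValue.algorithm1-value G f as valid
... | [] | () , _ | _
... | a₁ ∷ rest | (firstS , chain) , even | value
  with ds , links≡ , separated , realized ← Construction.realize G f f-sym a₁ rest firstS
                                              (algorithm1-admissible (a₁ ∷ rest) (firstS , chain) even) =
  ds , cong (λ ls → 1 ∷ 1 ∷ ls) links≡ , pairwiseSeparated⇒chain ds separated ,
  ≈-trans (≈-reflexive (Values.TIchain≡TIof G f ds)) (≈-trans realized value)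
  where open AbelianGroup G using () renaming (reflexive to ≈-reflexive; trans to ≈-trans)
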